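{- As (virtual) $\mathbb{L}$-species, $\mathrm{Cay}(231) = 1 + X + \bigl(4\,\mathrm{Cay}(231) - E\bigr)*\mathrm{Cay}(231)_+$.
   Context: A Cayley permutation of length $n$ is a word $w=w_1\cdots w_n$ of positive integers with $\{w_1,\dots,w_n\}=[k]$ for some $k\le n$. It contains $231$ if there are $i<j<k$ with $w_k<w_i<w_j$, and otherwise avoids $231$. An $\mathbb{L}$-species assigns to each finite totally ordered set a finite set of structures, functorially in order-preserving bijections; since $\mathbb{L}$-species are determined up to isomorphism by the numbers $|F[n]|$, virtual $\mathbb{L}$-species (formal differences) and identities between them are determined by these numbers (equivalently by exponential generating series $F(x)=\sum_n|F[n]|x^n/n!$). $\mathrm{Cay}(231)$ is the $\mathbb{L}$-species of $231$-avoiding Cayley permutations and $\mathrm{Cay}(231)_+$ its restriction to nonempty sets. $1$: one structure on the empty set only; $X$: one structure on each one-element set only; $E$: one structure on every set. Sum is disjoint union and $4F=F+F+F+F$; ordinal product $(F\odot G)[\ell]=\bigsqcup_{\ell=\ell_1\oplus\ell_2}F[\ell_1]\times G[\ell_2]$ over splittings of $\ell$ into an initial segment $\ell_1$ and terminal segment $\ell_2$; convolution $F*G=F\odot X\odot G$ (extended bilinearly to virtual species), whose generating series is $\int_0^x F(x-t)G(t)\,dt$. -}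

module Defs where

open import Data.Nat as ℕ using (ℕ; zero; suc; _<ᵇ_; _≡ᵇ_)
open import Data.Integer as ℤ using (ℤ; +_; _-_)
open import Data.Bool using (Bool; true; false; _∧_; _∨_; not; if_then_else_)
open import Data.List using (List; []; _∷_; length; filter; map; concatMap; upTo; foldr)
open import Data.Bool.ListAction using (any; all)
open import Relation.Nullary.Decidable using (yes; no)
open import Relation.Binary.PropositionalEquality using (_≡_)
open import Data.Bool.Properties using (T?)

words : ℕ → ℕ → List (List ℕ)
words zero    m = [] ∷ []
words (suc l) m = concatMap (λ a → map (a ∷_) (words l m)) (map suc (upTo m))

maxL : List ℕ → ℕ
maxL = foldr ℕ._⊔_ 0

elem : ℕ → List ℕ → Bool
elem a = any (λ b → a ≡ᵇ b)

isCayley : List ℕ → Bool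
isCayley w = all (λ b → 0 <ᵇ b) w ∧ all (λ k → elem (suc k) w) (upTo (maxL w))

pair231 : ℕ → List ℕ → Bool
pair231 a []      = false
pair231 a (b ∷ v) = ((a <ᵇ b) ∧ any (λ c → c <ᵇ a) v) ∨ pair231 a v

contains231 : List ℕ → Bool
contains231 []      = false
contains231 (a ∷ v) = pair231 a v ∨ contains231 v

-- number of 231-avoiding Cayley permutations of length n
-- (a Cayley permutation of length n has letters in [n])
cay231 : ℕ → ℕ
cay231 n = length (filter (λ w → T? (isCayley w ∧ not (contains231 w))) (words n n))

-- Virtual L-species, represented (up to isomorphism) by their counts |F[n]|

VSpecies : Set
VSpecies = ℕ → ℤ

Cay231 : VSpecies
Cay231 n = + cay231 n

_₊ : VSpecies → VSpecies
(F ₊) zero    = + 0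
(F ₊) (suc n) = F (suc n)

𝟙 : VSpecies
𝟙 zero    = + 1
𝟙 (suc n) = + 0

𝕏 : VSpecies
𝕏 1 = + 1
𝕏 _ = + 0

𝔼 : VSpecies
𝔼 _ = + 1

infixl 6 _⊕_ _⊖_
infixl 7 _⊛_ _⊙_ _·_

_⊕_ : VSpecies → VSpecies → VSpecies
(F ⊕ G) n = F n ℤ.+ G n

_⊖_ : VSpecies → VSpecies → VSpecies
(F ⊖ G) n = F n - G n

_·_ : ℕ → VSpecies → VSpecies
(k · F) n = + k ℤ.* F n

-- sum over splittings of [n] into initial segment of size i and terminal of size n - i
splitSum : (ℕ → ℕ → ℤ) → ℕ → ℤ
splitSum f n = foldr ℤ._+_ (+ 0) (map (λ i → f i (n ℕ.∸ i)) (upTo (suc n)))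

_⊙_ : VSpecies → VSpecies → VSpecies
(F ⊙ G) n = splitSum (λ i j → F i ℤ.* G j) n

_⊛_ : VSpecies → VSpecies → VSpecies
F ⊛ G = F ⊙ 𝕏 ⊙ G

-- Cut a nonempty 231-avoiding Cayley permutation w at the first occurrence of
-- its maximum m, w = α m β.  Then α is an arbitrary 231-avoiding Cayley
-- permutation, with maximum b < m say, and β avoids 231, has its letters in
-- [b, m] (a smaller letter would complete a 231 with b and m) and contains every
-- value strictly between b and m.  With K = m − b − 1, such β are translates of
-- 231-avoiding Cayley permutations with maximum K or K + 1 when b ∉ β, and
-- K + 1 or K + 2 when b ∈ β, which needs b > 0.  Summing over m, with
-- c = |Cay(231)|, a prefix leaves 2 c(ℓ) − [ℓ = 0] tails of length ℓ when it is
-- empty and 4 c(ℓ) − 3 [ℓ = 0] − [ℓ > 0] otherwise.  Against the convolution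
-- terms c(i) (4 c(ℓ) − 1) the only discrepancies are the empty-prefix term
-- 2 c(n − 1) and the term with ℓ = 0, which counts c(n − 1) instead of
-- 3 c(n − 1); they cancel.

module Submission where

open import Defs
open import Data.Nat
  using (ℕ; zero; suc; _+_; _*_; _∸_; _≤_; _<_; z≤n; s≤s; _<ᵇ_; _≡ᵇ_; _≤ᵇ_; _≤?_; _<?_; _≟_)
open import Data.Nat.Properties
open import Data.Bool using (Bool; true; false; _∧_; _∨_; not; T)
open import Data.Bool.Properties using (T?; ∧-zeroʳ; ∨-identityʳ; ∨-assoc)
open import Data.Bool.ListAction using (all; any; and)
open import Data.Product using (_×_; _,_; proj₁; proj₂)
open import Data.List.Relation.Unary.All as All using (All; []; _∷_)
open import Data.List
  using (List; []; _∷_; _++_; length; filter; map; foldr; concatMap; upTo; applyUpTo;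
         takeWhileᵇ; dropWhileᵇ; head; replicate)
open import Data.List.Properties
  using (map-cong; map-id; length-++-sucʳ; ++-identityʳ; takeWhile++dropWhile)
open import Data.List.Relation.Unary.All.Properties
  using (all⁺; all⁻; ++⁺; ++⁻ˡ; ++⁻ʳ; all-takeWhile; all-head-dropWhile; replicate⁺)
open import Data.Maybe.Relation.Unary.All as Maybe using (just)
open import Data.List.Relation.Unary.Any as Any using (here; there)
open import Data.List.Relation.Unary.Any.Properties using (any⁺; any⁻; ++⁺ˡ)
open import Data.List.Membership.Propositional using (_∈_)
open import Data.List.Membership.Propositional.Properties
  using (∈-upTo⁺; ∈-upTo⁻; ∈-∃++; ∈-++⁻; ∈-++⁺ˡ; ∈-++⁺ʳ)
open import Data.Sum using (inj₁; inj₂)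
open import Data.Empty using (⊥-elim)
open import Relation.Nullary using (¬_; yes; no)
open import Function using (_∘_)
open import Data.Nat.Tactic.RingSolver using (solve-∀)
open import Data.Integer as ℤ using (ℤ)
import Data.Integer.Properties as ℤ
import Data.Integer.Tactic.RingSolver as ℤ-Solver
open import Relation.Binary.PropositionalEquality
open import Algebra.Properties.CommutativeSemigroup +-commutativeSemigroup
  using () renaming (interchange to +-interchange)

private
  variable
    A B : Set

infix 9 ∑ ∑< ∑ℤ

∑ : List A → (A → ℕ) → ℕ
∑ []       f = 0
∑ (x ∷ xs) f = f x + ∑ xs f

syntax ∑ xs (λ x → e) = ∑[ x ∈ xs ] e

∑< : ℕ → (ℕ → ℕ) → ℕ
∑< zero    f = 0
∑< (suc n) f = f 0 + ∑< n (f ∘ suc)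

syntax ∑< n (λ i → e) = ∑[ i < n ] e

∑-cong : (xs : List A) {f g : A → ℕ} → (∀ x → f x ≡ g x) → ∑ xs f ≡ ∑ xs g
∑-cong []       eq = refl
∑-cong (x ∷ xs) eq = cong₂ _+_ (eq x) (∑-cong xs eq)

∑-0 : (xs : List A) → ∑[ x ∈ xs ] 0 ≡ 0
∑-0 []       = refl
∑-0 (x ∷ xs) = ∑-0 xs

∑-+ : (xs : List A) (f g : A → ℕ) → ∑[ x ∈ xs ] (f x + g x) ≡ ∑ xs f + ∑ xs g
∑-+ []       f g = refl
∑-+ (x ∷ xs) f g =
  trans (cong (f x + g x +_) (∑-+ xs f g)) (+-interchange (f x) (g x) (∑ xs f) (∑ xs g))

∑-*ˡ : (xs : List A) (c : ℕ) (f : A → ℕ) → ∑[ x ∈ xs ] (c * f x) ≡ c * ∑ xs f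
∑-*ˡ []       c f = sym (*-zeroʳ c)
∑-*ˡ (x ∷ xs) c f = trans (cong (c * f x +_) (∑-*ˡ xs c f)) (sym (*-distribˡ-+ c (f x) (∑ xs f)))

∑-*ʳ : (xs : List A) (c : ℕ) (f : A → ℕ) → ∑[ x ∈ xs ] (f x * c) ≡ ∑ xs f * c
∑-*ʳ xs c f = trans (∑-cong xs (λ x → *-comm (f x) c)) (trans (∑-*ˡ xs c f) (*-comm c (∑ xs f)))

∑-++ : (xs ys : List A) (f : A → ℕ) → ∑ (xs ++ ys) f ≡ ∑ xs f + ∑ ys f
∑-++ []       ys f = refl
∑-++ (x ∷ xs) ys f = trans (cong (f x +_) (∑-++ xs ys f)) (sym (+-assoc (f x) (∑ xs f) (∑ ys f)))

∑-map : (h : A → B) (xs : List A) (f : B → ℕ) → ∑ (map h xs) f ≡ ∑[ x ∈ xs ] f (h x)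
∑-map h []       f = refl
∑-map h (x ∷ xs) f = cong (f (h x) +_) (∑-map h xs f)

∑-concatMap : (h : A → List B) (xs : List A) (f : B → ℕ) →
              ∑ (concatMap h xs) f ≡ ∑[ x ∈ xs ] ∑ (h x) f
∑-concatMap h []       f = refl
∑-concatMap h (x ∷ xs) f = trans (∑-++ (h x) (concatMap h xs) f) (cong (∑ (h x) f +_) (∑-concatMap h xs f))

∑-applyUpTo : (h : ℕ → A) (n : ℕ) (f : A → ℕ) → ∑ (applyUpTo h n) f ≡ ∑[ i < n ] f (h i)
∑-applyUpTo h zero    f = refl
∑-applyUpTo h (suc n) f = cong (f (h 0) +_) (∑-applyUpTo (h ∘ suc) n f)

∑-∑<-comm : (xs : List A) (n : ℕ) (f : A → ℕ → ℕ) →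
            ∑[ x ∈ xs ] ∑[ i < n ] f x i ≡ ∑[ i < n ] ∑[ x ∈ xs ] f x i
∑-∑<-comm xs zero    f = ∑-0 xs
∑-∑<-comm xs (suc n) f = trans (∑-+ xs (λ x → f x 0) (λ x → ∑[ i < n ] f x (suc i)))
                               (cong ((∑[ x ∈ xs ] f x 0) +_) (∑-∑<-comm xs n (λ x → f x ∘ suc)))

∑<-as-∑ : (n : ℕ) (f : ℕ → ℕ) → ∑< n f ≡ ∑ (upTo n) f
∑<-as-∑ n f = sym (∑-applyUpTo (λ i → i) n f)

∑<-cong : (n : ℕ) {f g : ℕ → ℕ} → (∀ i → i < n → f i ≡ g i) → ∑< n f ≡ ∑< n g
∑<-cong zero    eq = refl
∑<-cong (suc n) eq = cong₂ _+_ (eq 0 (s≤s z≤n)) (∑<-cong n (λ i i<n → eq (suc i) (s≤s i<n)))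

∑<-0 : (n : ℕ) {f : ℕ → ℕ} → (∀ i → f i ≡ 0) → ∑< n f ≡ 0
∑<-0 zero    eq = refl
∑<-0 (suc n) eq = cong₂ _+_ (eq 0) (∑<-0 n (eq ∘ suc))

∑<-+ : (n : ℕ) (f g : ℕ → ℕ) → ∑[ i < n ] (f i + g i) ≡ ∑< n f + ∑< n g
∑<-+ zero    f g = refl
∑<-+ (suc n) f g =
  trans (cong (f 0 + g 0 +_) (∑<-+ n (f ∘ suc) (g ∘ suc))) (+-interchange (f 0) (g 0) _ _)

∑<-*ˡ : (n c : ℕ) (f : ℕ → ℕ) → ∑[ i < n ] (c * f i) ≡ c * ∑< n f
∑<-*ˡ n c f = trans (∑<-as-∑ n _) (trans (∑-*ˡ (upTo n) c f) (cong (c *_) (sym (∑<-as-∑ n f))))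

∑<-*ʳ : (n c : ℕ) (f : ℕ → ℕ) → ∑[ i < n ] (f i * c) ≡ ∑< n f * c
∑<-*ʳ n c f = trans (∑<-as-∑ n _) (trans (∑-*ʳ (upTo n) c f) (cong (_* c) (sym (∑<-as-∑ n f))))

∑<-comm : (n m : ℕ) (f : ℕ → ℕ → ℕ) → ∑[ i < n ] ∑[ j < m ] f i j ≡ ∑[ j < m ] ∑[ i < n ] f i j
∑<-comm n m f = trans (∑<-as-∑ n _) (trans (∑-∑<-comm (upTo n) m f)
                  (∑<-cong m (λ j _ → sym (∑<-as-∑ n (λ i → f i j)))))

∑<-last : (n : ℕ) (f : ℕ → ℕ) → ∑< (suc n) f ≡ ∑< n f + f n
∑<-last zero    f = +-comm (f 0) 0
∑<-last (suc n) f = trans (cong (f 0 +_) (∑<-last n (f ∘ suc))) (sym (+-assoc (f 0) _ _))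

∑<-extend : (n k : ℕ) (f : ℕ → ℕ) → (∀ i → n ≤ i → f i ≡ 0) → ∑< (n + k) f ≡ ∑< n f
∑<-extend n zero    f vanish = cong (λ t → ∑< t f) (+-identityʳ n)
∑<-extend n (suc k) f vanish = begin
  ∑< (n + suc k) f    ≡⟨ cong (λ t → ∑< t f) (+-suc n k) ⟩
  ∑< (suc (n + k)) f  ≡⟨ ∑<-last (n + k) f ⟩
  ∑< (n + k) f + f (n + k) ≡⟨ cong (∑< (n + k) f +_) (vanish (n + k) (m≤m+n n k)) ⟩
  ∑< (n + k) f + 0    ≡⟨ +-identityʳ _ ⟩
  ∑< (n + k) f        ≡⟨ ∑<-extend n k f vanish ⟩
  ∑< n f              ∎
  where open ≡-Reasoning

⟦_⟧ : Bool → ℕ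
⟦ true  ⟧ = 1
⟦ false ⟧ = 0

⟦∧⟧ : ∀ a b → ⟦ a ∧ b ⟧ ≡ ⟦ a ⟧ * ⟦ b ⟧
⟦∧⟧ true  b = sym (+-identityʳ ⟦ b ⟧)
⟦∧⟧ false b = refl

⟦∧⟧-* : ∀ a b x → ⟦ a ∧ b ⟧ * x ≡ ⟦ a ⟧ * (⟦ b ⟧ * x)
⟦∧⟧-* a b x = trans (cong (_* x) (⟦∧⟧ a b)) (*-assoc ⟦ a ⟧ ⟦ b ⟧ x)

∑<-select : (n k : ℕ) (f : ℕ → ℕ) → k < n → ∑[ i < n ] (⟦ i ≡ᵇ k ⟧ * f i) ≡ f k
∑<-select (suc n) zero    f _ =
  trans (cong₂ _+_ (+-identityʳ (f 0)) (∑<-0 n (λ _ → refl))) (+-identityʳ (f 0))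
∑<-select (suc n) (suc k) f (s≤s k<n) = ∑<-select n k (f ∘ suc) k<n

∑-words-suc : (ℓ M : ℕ) (f : List ℕ → ℕ) →
              ∑ (words (suc ℓ) M) f ≡ ∑[ a < M ] ∑[ v ∈ words ℓ M ] f (suc a ∷ v)
∑-words-suc ℓ M f = begin
  ∑ (concatMap (λ a → map (a ∷_) (words ℓ M)) (map suc (upTo M))) f
    ≡⟨ ∑-concatMap (λ a → map (a ∷_) (words ℓ M)) (map suc (upTo M)) f ⟩
  ∑[ a ∈ map suc (upTo M) ] ∑ (map (a ∷_) (words ℓ M)) f
    ≡⟨ ∑-map suc (upTo M) _ ⟩
  ∑[ a ∈ upTo M ] ∑ (map (suc a ∷_) (words ℓ M)) f
    ≡⟨ sym (∑<-as-∑ M _) ⟩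
  ∑[ a < M ] ∑ (map (suc a ∷_) (words ℓ M)) f
    ≡⟨ ∑<-cong M (λ a _ → ∑-map (suc a ∷_) (words ℓ M) f) ⟩
  ∑[ a < M ] ∑[ v ∈ words ℓ M ] f (suc a ∷ v) ∎
  where open ≡-Reasoning

Letter : ℕ → ℕ → Set
Letter M x = 0 < x × x ≤ M

∑-words-cong : (ℓ M : ℕ) {f g : List ℕ → ℕ} →
               (∀ w → All (Letter M) w → length w ≡ ℓ → f w ≡ g w) →
               ∑ (words ℓ M) f ≡ ∑ (words ℓ M) g
∑-words-cong zero    M eq = cong (_+ 0) (eq [] [] refl)
∑-words-cong (suc ℓ) M {f} {g} eq = begin
  ∑ (words (suc ℓ) M) f                  ≡⟨ ∑-words-suc ℓ M f ⟩
  ∑[ a < M ] ∑[ v ∈ words ℓ M ] f (suc a ∷ v)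
    ≡⟨ ∑<-cong M (λ a a<M → ∑-words-cong ℓ M (λ v v∈ ∣v∣ → eq (suc a ∷ v) ((s≤s z≤n , a<M) ∷ v∈) (cong suc ∣v∣))) ⟩
  ∑[ a < M ] ∑[ v ∈ words ℓ M ] g (suc a ∷ v) ≡⟨ sym (∑-words-suc ℓ M g) ⟩
  ∑ (words (suc ℓ) M) g                  ∎
  where open ≡-Reasoning

module _ (M : ℕ) (q : ℕ → Bool) where

  prefixSum : (List ℕ → ℕ) → ℕ → ℕ
  prefixSum f i = ∑[ α ∈ words i M ] (⟦ all q α ⟧ * f α)

  prefixSum-zero : (f : List ℕ → ℕ) → prefixSum f 0 ≡ f []
  prefixSum-zero f = trans (+-identityʳ (⟦ true ⟧ * f [])) (*-identityˡ (f []))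

  prefixSum-suc : (f : List ℕ → ℕ) (i : ℕ) →
                  prefixSum f (suc i) ≡ ∑[ a < M ] (⟦ q (suc a) ⟧ * prefixSum (f ∘ (suc a ∷_)) i)
  prefixSum-suc f i = trans (∑-words-suc i M _) (∑<-cong M (λ a _ →
    trans (∑-cong (words i M) (λ α → ⟦∧⟧-* (q (suc a)) (all q α) (f (suc a ∷ α))))
          (∑-*ˡ (words i M) ⟦ q (suc a) ⟧ (λ α → ⟦ all q α ⟧ * f (suc a ∷ α)))))

  ∑-prefixSum-suc : (f : List ℕ → ℕ) (n : ℕ) (s : ℕ → ℕ) →
    ∑[ a < M ] (⟦ q (suc a) ⟧ * ∑[ i < suc n ] (prefixSum (f ∘ (suc a ∷_)) i * s (n ∸ i))) ≡
    ∑[ i < suc n ] (prefixSum f (suc i) * s (n ∸ i))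
  ∑-prefixSum-suc f n s = begin
    ∑[ a < M ] (⟦ q (suc a) ⟧ * ∑[ i < suc n ] (P a i * s (n ∸ i)))
      ≡⟨ ∑<-cong M (λ a _ → sym (∑<-*ˡ (suc n) ⟦ q (suc a) ⟧ (λ i → P a i * s (n ∸ i)))) ⟩
    ∑[ a < M ] ∑[ i < suc n ] (⟦ q (suc a) ⟧ * (P a i * s (n ∸ i)))
      ≡⟨ ∑<-comm M (suc n) (λ a i → ⟦ q (suc a) ⟧ * (P a i * s (n ∸ i))) ⟩
    ∑[ i < suc n ] ∑[ a < M ] (⟦ q (suc a) ⟧ * (P a i * s (n ∸ i)))
      ≡⟨ ∑<-cong (suc n) (λ i _ → trans (∑<-cong M (λ a _ → sym (*-assoc ⟦ q (suc a) ⟧ (P a i) (s (n ∸ i)))))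
                                        (∑<-*ʳ M (s (n ∸ i)) (λ a → ⟦ q (suc a) ⟧ * P a i))) ⟩
    ∑[ i < suc n ] (∑[ a < M ] (⟦ q (suc a) ⟧ * P a i) * s (n ∸ i))
      ≡⟨ ∑<-cong (suc n) (λ i _ → cong (_* s (n ∸ i)) (sym (prefixSum-suc f i))) ⟩
    ∑[ i < suc n ] (prefixSum f (suc i) * s (n ∸ i)) ∎
    where
    open ≡-Reasoning
    P : ℕ → ℕ → ℕ
    P a = prefixSum (f ∘ (suc a ∷_))

  -- Every word is its longest q-prefix followed by a suffix not starting
  -- with a q-letter; as g vanishes on q-headed suffixes no other cut contributes.
  ∑-words-split : (n : ℕ) (f g : List ℕ → ℕ) → (∀ x γ → T (q x) → g (x ∷ γ) ≡ 0) →
    ∑[ w ∈ words n M ] (f (takeWhileᵇ q w) * g (dropWhileᵇ q w)) ≡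
    ∑[ i < suc n ] (prefixSum f i * ∑ (words (n ∸ i) M) g)
  ∑-words-split zero    f g _ = cong (_+ 0) (cong₂ _*_ (sym (prefixSum-zero f)) (sym (+-identityʳ (g []))))
  ∑-words-split (suc n) f g g-vanish = begin
    ∑[ w ∈ words (suc n) M ] (f (takeWhileᵇ q w) * g (dropWhileᵇ q w))
      ≡⟨ ∑-words-suc n M _ ⟩
    ∑[ a < M ] ∑[ v ∈ words n M ] (f (takeWhileᵇ q (suc a ∷ v)) * g (dropWhileᵇ q (suc a ∷ v)))
      ≡⟨ ∑<-cong M (λ a _ → by-first-letter a) ⟩
    ∑[ a < M ] (f [] * startingWith a + ⟦ q (suc a) ⟧ * splits a)
      ≡⟨ ∑<-+ M (λ a → f [] * startingWith a) (λ a → ⟦ q (suc a) ⟧ * splits a) ⟩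
    ∑[ a < M ] (f [] * startingWith a) + ∑[ a < M ] (⟦ q (suc a) ⟧ * splits a)
      ≡⟨ cong₂ _+_ empty-prefix (∑-prefixSum-suc f n suffixSum) ⟩
    prefixSum f 0 * suffixSum (suc n) + ∑[ i < suc n ] (prefixSum f (suc i) * suffixSum (n ∸ i)) ∎
    where
    open ≡-Reasoning
    suffixSum : ℕ → ℕ
    suffixSum j = ∑ (words j M) g
    startingWith : ℕ → ℕ
    startingWith a = ∑[ v ∈ words n M ] g (suc a ∷ v)
    splits : ℕ → ℕ
    splits a = ∑[ i < suc n ] (prefixSum (f ∘ (suc a ∷_)) i * suffixSum (n ∸ i))
    by-first-letter : ∀ a →
      ∑[ v ∈ words n M ] (f (takeWhileᵇ q (suc a ∷ v)) * g (dropWhileᵇ q (suc a ∷ v))) ≡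
      f [] * startingWith a + ⟦ q (suc a) ⟧ * splits a
    by-first-letter a with q (suc a) in qa
    ... | false = trans (∑-*ˡ (words n M) (f []) (λ v → g (suc a ∷ v))) (sym (+-identityʳ _))
    ... | true  = begin
      ∑[ v ∈ words n M ] (f (suc a ∷ takeWhileᵇ q v) * g (dropWhileᵇ q v)) ≡⟨ ∑-words-split n (f ∘ (suc a ∷_)) g g-vanish ⟩
      splits a                                                            ≡⟨ *-identityˡ (splits a) ⟨
      ⟦ true ⟧ * splits a                                                 ≡⟨ cong (_+ ⟦ true ⟧ * splits a) no-empty-prefix ⟨
      f [] * startingWith a + ⟦ true ⟧ * splits a                         ∎
      where
      no-empty-prefix : f [] * startingWith a ≡ 0
      no-empty-prefix = trans (cong (f [] *_) (trans (∑-cong (words n M) (λ v → g-vanish (suc a) v (subst T (sym qa) _)))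
                                                     (∑-0 (words n M))))
                              (*-zeroʳ (f []))
    empty-prefix : ∑[ a < M ] (f [] * startingWith a) ≡ prefixSum f 0 * suffixSum (suc n)
    empty-prefix = trans (∑<-*ˡ M (f []) startingWith)
                         (cong₂ _*_ (sym (prefixSum-zero f)) (sym (∑-words-suc n M g)))

inWindow : ℕ → ℕ → ℕ → Bool
inWindow c K y = (c <ᵇ y) ∧ (y ≤ᵇ c + K)

∑<-below : (M K : ℕ) → K ≤ M → (h : ℕ → ℕ) → ∑[ a < M ] (⟦ a <ᵇ K ⟧ * h a) ≡ ∑< K h
∑<-below M       zero    _         h = ∑<-0 M (λ _ → refl)
∑<-below (suc M) (suc K) (s≤s K≤M) h = cong₂ _+_ (*-identityˡ (h 0)) (∑<-below M K K≤M (h ∘ suc))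

∑<-window : (c K M : ℕ) → c + K ≤ M → (h : ℕ → ℕ) →
            ∑[ a < M ] (⟦ inWindow c K (suc a) ⟧ * h (suc a)) ≡ ∑[ d < K ] h (c + suc d)
∑<-window zero    K M       c+K≤M       h = ∑<-below M K c+K≤M (h ∘ suc)
∑<-window (suc c) K (suc M) (s≤s c+K≤M) h = ∑<-window c K M c+K≤M (h ∘ suc)

∑-words-window : (ℓ c K M : ℕ) → c + K ≤ M → (f : List ℕ → ℕ) →
  ∑[ β ∈ words ℓ M ] (⟦ all (inWindow c K) β ⟧ * f β) ≡ ∑[ β ∈ words ℓ K ] f (map (c +_) β)
∑-words-window zero    c K M _     f = cong (_+ 0) (*-identityˡ (f []))
∑-words-window (suc ℓ) c K M c+K≤M f = begin
  ∑[ β ∈ words (suc ℓ) M ] (⟦ all (inWindow c K) β ⟧ * f β)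
    ≡⟨ ∑-words-suc ℓ M _ ⟩
  ∑[ a < M ] ∑[ v ∈ words ℓ M ] (⟦ inWindow c K (suc a) ∧ all (inWindow c K) v ⟧ * f (suc a ∷ v))
    ≡⟨ ∑<-cong M (λ a _ → first-letter a) ⟩
  ∑[ a < M ] (⟦ inWindow c K (suc a) ⟧ * ∑[ v ∈ words ℓ K ] f (suc a ∷ map (c +_) v))
    ≡⟨ ∑<-window c K M c+K≤M (λ y → ∑[ v ∈ words ℓ K ] f (y ∷ map (c +_) v)) ⟩
  ∑[ d < K ] ∑[ v ∈ words ℓ K ] f (c + suc d ∷ map (c +_) v)
    ≡⟨ ∑-words-suc ℓ K _ ⟨
  ∑[ β ∈ words (suc ℓ) K ] f (map (c +_) β) ∎
  where
  open ≡-Reasoning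
  first-letter : ∀ a →
    ∑[ v ∈ words ℓ M ] (⟦ inWindow c K (suc a) ∧ all (inWindow c K) v ⟧ * f (suc a ∷ v)) ≡
    ⟦ inWindow c K (suc a) ⟧ * ∑[ v ∈ words ℓ K ] f (suc a ∷ map (c +_) v)
  first-letter a = begin
    ∑[ v ∈ words ℓ M ] (⟦ inWindow c K (suc a) ∧ all (inWindow c K) v ⟧ * f (suc a ∷ v))
      ≡⟨ ∑-cong (words ℓ M) (λ v → ⟦∧⟧-* (inWindow c K (suc a)) (all (inWindow c K) v) (f (suc a ∷ v))) ⟩
    ∑[ v ∈ words ℓ M ] (⟦ inWindow c K (suc a) ⟧ * (⟦ all (inWindow c K) v ⟧ * f (suc a ∷ v)))
      ≡⟨ ∑-*ˡ (words ℓ M) ⟦ inWindow c K (suc a) ⟧ _ ⟩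
    ⟦ inWindow c K (suc a) ⟧ * ∑[ v ∈ words ℓ M ] (⟦ all (inWindow c K) v ⟧ * f (suc a ∷ v))
      ≡⟨ cong (⟦ inWindow c K (suc a) ⟧ *_) (∑-words-window ℓ c K M c+K≤M (λ v → f (suc a ∷ v))) ⟩
    ⟦ inWindow c K (suc a) ⟧ * ∑[ v ∈ words ℓ K ] f (suc a ∷ map (c +_) v) ∎

T-∧⁺ : ∀ {a b} → T a → T b → T (a ∧ b)
T-∧⁺ {true} _ tb = tb

T-∧⁻ˡ : ∀ a {b} → T (a ∧ b) → T a
T-∧⁻ˡ true _ = _

T-∧⁻ʳ : ∀ a {b} → T (a ∧ b) → T b
T-∧⁻ʳ true t = t

T-∨ˡ : ∀ a {b} → T a → T (a ∨ b)
T-∨ˡ true _ = _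

T-∨ʳ : ∀ a {b} → T b → T (a ∨ b)
T-∨ʳ true  _  = _
T-∨ʳ false tb = tb

T-∧-monoʳ : ∀ a {b c} → (T b → T c) → T (a ∧ b) → T (a ∧ c)
T-∧-monoʳ true f = f

T-∨-mono : ∀ a {b c d} → (T a → T c) → (T b → T d) → T (a ∨ b) → T (c ∨ d)
T-∨-mono true  {c = c} f g t = T-∨ˡ c (f t)
T-∨-mono false {c = c} f g t = T-∨ʳ c (g t)

¬T⇒≡false : ∀ {a} → ¬ T a → a ≡ false
¬T⇒≡false {true}  ¬t = ⊥-elim (¬t _)
¬T⇒≡false {false} _  = refl

≡false⇒¬T : ∀ {a} → a ≡ false → ¬ T a
≡false⇒¬T refl ()

⟦⟧-⇔ : ∀ {a b} → (T a → T b) → (T b → T a) → ⟦ a ⟧ ≡ ⟦ b ⟧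
⟦⟧-⇔ {true}  {true}  _ _ = refl
⟦⟧-⇔ {true}  {false} f _ = ⊥-elim (f _)
⟦⟧-⇔ {false} {true}  _ g = ⊥-elim (g _)
⟦⟧-⇔ {false} {false} _ _ = refl

⟦⟧-false : ∀ {a} → ¬ T a → ⟦ a ⟧ ≡ 0
⟦⟧-false ¬t = cong ⟦_⟧ (¬T⇒≡false ¬t)

≤⇒≮ᵇ : ∀ {a c} → a ≤ c → (c <ᵇ a) ≡ false
≤⇒≮ᵇ {a} {c} a≤c = ¬T⇒≡false (λ c<ᵇa → <⇒≱ (<ᵇ⇒< c a c<ᵇa) a≤c)

elem⁺ : ∀ {x} w → x ∈ w → T (elem x w)
elem⁺ {x} w x∈w = any⁺ _ (Any.map (≡⇒≡ᵇ x _) x∈w)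

elem⁻ : ∀ {x} w → T (elem x w) → x ∈ w
elem⁻ {x} w t = Any.map (≡ᵇ⇒≡ x _) (any⁻ _ w t)

maxL-upper : ∀ {x} w → x ∈ w → x ≤ maxL w
maxL-upper (y ∷ w) (here refl) = m≤m⊔n y (maxL w)
maxL-upper (y ∷ w) (there x∈w) = m≤n⇒m≤o⊔n y (maxL-upper w x∈w)

maxL-least : ∀ {K} w → All (_≤ K) w → maxL w ≤ K
maxL-least []      []         = z≤n
maxL-least (y ∷ w) (y≤K ∷ w≤K) = ⊔-lub y≤K (maxL-least w w≤K)

maxL-∈ : ∀ y w → maxL (y ∷ w) ∈ y ∷ w
maxL-∈ y []      = here (⊔-identityʳ y)
maxL-∈ y (z ∷ w) with ⊔-sel y (maxL (z ∷ w))
... | inj₁ eq = here eq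
... | inj₂ eq = there (subst (_∈ z ∷ w) (sym eq) (maxL-∈ z w))

covers : ℕ → ℕ → List ℕ → Bool
covers c K β = all (λ k → elem (c + suc k) β) (upTo K)

Covers : ℕ → ℕ → List ℕ → Set
Covers c K β = ∀ {k} → k < K → c + suc k ∈ β

covers⁺ : ∀ c K β → Covers c K β → T (covers c K β)
covers⁺ c K β cov = all⁻ _ (All.tabulate (λ k∈ → elem⁺ β (cov (∈-upTo⁻ k∈))))

covers⁻ : ∀ c K β → T (covers c K β) → Covers c K β
covers⁻ c K β t k<K = elem⁻ β (All.lookup (all⁺ _ (upTo K) t) (∈-upTo⁺ k<K))

any-++ : ∀ (p : ℕ → Bool) u v → any p (u ++ v) ≡ any p u ∨ any p v
any-++ p []      v = refl
any-++ p (x ∷ u) v = trans (cong (p x ∨_) (any-++ p u v)) (sym (∨-assoc (p x) (any p u) (any p v)))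

none-below : ∀ a v → All (a ≤_) v → any (_<ᵇ a) v ≡ false
none-below a []      []          = refl
none-below a (c ∷ v) (a≤c ∷ a≤v) rewrite ≤⇒≮ᵇ a≤c = none-below a v a≤v

pair231-≥ : ∀ a v → All (a ≤_) v → pair231 a v ≡ false
pair231-≥ a []      []        = refl
pair231-≥ a (b ∷ v) (_ ∷ a≤v) rewrite none-below a v a≤v | ∧-zeroʳ (a <ᵇ b) = pair231-≥ a v a≤v

pair231-≤ : ∀ m v → All (_≤ m) v → pair231 m v ≡ false
pair231-≤ m []      []          = refl
pair231-≤ m (c ∷ v) (c≤m ∷ v≤m) rewrite ≤⇒≮ᵇ c≤m = pair231-≤ m v v≤m

pair231-++-≥ : ∀ a u v → All (a ≤_) v → pair231 a (u ++ v) ≡ pair231 a u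
pair231-++-≥ a []      v a≤v = pair231-≥ a v a≤v
pair231-++-≥ a (b ∷ u) v a≤v
  rewrite pair231-++-≥ a u v a≤v | any-++ (_<ᵇ a) u v | none-below a v a≤v
        | ∨-identityʳ (any (_<ᵇ a) u) = refl

contains231-++ : ∀ u v → All (λ x → All (x ≤_) v) u →
                 contains231 (u ++ v) ≡ contains231 u ∨ contains231 v
contains231-++ []      v _              = refl
contains231-++ (a ∷ u) v (a≤v ∷ u≤v) rewrite pair231-++-≥ a u v a≤v | contains231-++ u v u≤v =
  sym (∨-assoc (pair231 a u) (contains231 u) (contains231 v))

pair231-++ˡ : ∀ a u v → T (pair231 a u) → T (pair231 a (u ++ v))
pair231-++ˡ a (b ∷ u) v = T-∨-mono ((a <ᵇ b) ∧ any (_<ᵇ a) u)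
  (T-∧-monoʳ (a <ᵇ b) (λ t → any⁺ _ (++⁺ˡ (any⁻ _ u t)))) (pair231-++ˡ a u v)

contains231-++ˡ : ∀ u v → T (contains231 u) → T (contains231 (u ++ v))
contains231-++ˡ (a ∷ u) v = T-∨-mono (pair231 a u) (pair231-++ˡ a u v) (contains231-++ˡ u v)

contains231-++ʳ : ∀ u v → T (contains231 v) → T (contains231 (u ++ v))
contains231-++ʳ []      v t = t
contains231-++ʳ (a ∷ u) v t = T-∨ʳ (pair231 a (u ++ v)) (contains231-++ʳ u v t)

pair231-witness : ∀ {a m y} u β → a < m → y ∈ β → y < a → T (pair231 a (u ++ m ∷ β))
pair231-witness []      β a<m y∈β y<a =
  T-∨ˡ _ (T-∧⁺ (<⇒<ᵇ a<m) (any⁺ _ (Any.map (λ { refl → <⇒<ᵇ y<a }) y∈β)))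
pair231-witness (b ∷ u) β a<m y∈β y<a = T-∨ʳ _ (pair231-witness u β a<m y∈β y<a)

contains231-witness : ∀ {x m y} α β → x ∈ α → y ∈ β → y < x → x < m → T (contains231 (α ++ m ∷ β))
contains231-witness (a ∷ α) β (here refl) y∈β y<x x<m = T-∨ˡ _ (pair231-witness α β x<m y∈β y<x)
contains231-witness (a ∷ α) β (there x∈α) y∈β y<x x<m = T-∨ʳ _ (contains231-witness α β x∈α y∈β y<x x<m)

≡ᵇ-+ : ∀ c x y → (c + x ≡ᵇ c + y) ≡ (x ≡ᵇ y)
≡ᵇ-+ zero    x y = refl
≡ᵇ-+ (suc c) x y = ≡ᵇ-+ c x y

<ᵇ-+ : ∀ c x y → (c + x <ᵇ c + y) ≡ (x <ᵇ y)
<ᵇ-+ zero    x y = refl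
<ᵇ-+ (suc c) x y = <ᵇ-+ c x y

elem-map-+ : ∀ c x β → elem (c + x) (map (c +_) β) ≡ elem x β
elem-map-+ c x []      = refl
elem-map-+ c x (y ∷ β) rewrite ≡ᵇ-+ c x y | elem-map-+ c x β = refl

any<-map-+ : ∀ c a v → any (_<ᵇ c + a) (map (c +_) v) ≡ any (_<ᵇ a) v
any<-map-+ c a []      = refl
any<-map-+ c a (y ∷ v) rewrite <ᵇ-+ c y a | any<-map-+ c a v = refl

pair231-map-+ : ∀ c a v → pair231 (c + a) (map (c +_) v) ≡ pair231 a v
pair231-map-+ c a []      = refl
pair231-map-+ c a (y ∷ v) rewrite <ᵇ-+ c a y | any<-map-+ c a v | pair231-map-+ c a v = refl

contains231-map-+ : ∀ c v → contains231 (map (c +_) v) ≡ contains231 v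
contains231-map-+ c []      = refl
contains231-map-+ c (a ∷ v) rewrite pair231-map-+ c a v | contains231-map-+ c v = refl

covers-map-+ : ∀ c d K β → covers (c + d) K (map (c +_) β) ≡ covers d K β
covers-map-+ c d K β = cong and (map-cong (λ k →
  trans (cong (λ t → elem t (map (c +_) β)) (+-assoc c d (suc k))) (elem-map-+ c (d + suc k) β)) (upTo K))

-- Cutting a 231-avoiding Cayley permutation at its first maximum

isCay231 : List ℕ → Bool
isCay231 w = isCayley w ∧ not (contains231 w)

record IsCay231 (w : List ℕ) : Set where
  field
    positive : All (0 <_) w
    covering : Covers 0 (maxL w) w
    avoids   : contains231 w ≡ false

T-not⁺ : ∀ {a} → a ≡ false → T (not a)
T-not⁺ refl = _

T-not⁻ : ∀ a → T (not a) → a ≡ false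
T-not⁻ false _ = refl

-- covers 0 (maxL w) w is literally the second conjunct of isCayley w.
isCay231⁺ : ∀ w → IsCay231 w → T (isCay231 w)
isCay231⁺ w c = T-∧⁺ (T-∧⁺ (all⁻ _ (All.map <⇒<ᵇ positive)) (covers⁺ 0 (maxL w) w covering)) (T-not⁺ avoids)
  where open IsCay231 c

isCay231⁻ : ∀ w → T (isCay231 w) → IsCay231 w
isCay231⁻ w t = record
  { positive = All.map (λ {x} → <ᵇ⇒< 0 x) (all⁺ _ w (T-∧⁻ˡ _ cayley))
  ; covering = covers⁻ 0 (maxL w) w (T-∧⁻ʳ (all (0 <ᵇ_) w) cayley)
  ; avoids   = T-not⁻ (contains231 w) (T-∧⁻ʳ (isCayley w) t)
  }
  where
  cayley = T-∧⁻ˡ (isCayley w) t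

covers-length : ∀ M w → Covers 0 M w → M ≤ length w
covers-length zero    w       _   = z≤n
covers-length (suc M) w cov with ∈-∃++ (cov ≤-refl)
... | ys , zs , refl = subst (suc M ≤_) (sym (length-++-sucʳ ys (suc M) zs))
                             (s≤s (covers-length M (ys ++ zs) cov′))
  where
  cov′ : Covers 0 M (ys ++ zs)
  cov′ {k} k<M with ∈-++⁻ ys (cov (m<n⇒m<1+n k<M))
  ... | inj₁ k∈ys         = ∈-++⁺ˡ k∈ys
  ... | inj₂ (here eq)    = ⊥-elim (<⇒≢ k<M (suc-injective eq))
  ... | inj₂ (there k∈zs) = ∈-++⁺ʳ ys k∈zs

IsCay231⇒max≤length : ∀ {w} → IsCay231 w → maxL w ≤ length w
IsCay231⇒max≤length {w} c = covers-length (maxL w) w (IsCay231.covering c)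

b+1+[k∸b]≡1+k : ∀ {b k} → b ≤ k → b + suc (k ∸ b) ≡ suc k
b+1+[k∸b]≡1+k {b} {k} b≤k = trans (+-suc b (k ∸ b)) (cong suc (m+[n∸m]≡n b≤k))

k∸b<m∸1+b : ∀ b k m → b ≤ k → suc k < m → k ∸ b < m ∸ suc b
k∸b<m∸1+b zero    k       (suc m) _         (s≤s k<m) = k<m
k∸b<m∸1+b (suc b) (suc k) (suc m) (s≤s b≤k) (s≤s k<m) = k∸b<m∸1+b b k m b≤k k<m

j<m∸1+b⇒b+1+j<m : ∀ b j m → j < m ∸ suc b → b + suc j < m
j<m∸1+b⇒b+1+j<m zero    j (suc m) j<m = s≤s j<m
j<m∸1+b⇒b+1+j<m (suc b) j (suc m) j<m = s≤s (j<m∸1+b⇒b+1+j<m b j m j<m)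

maxL-< : ∀ {m} α → 0 < m → All (_< m) α → maxL α < m
maxL-< []      0<m []          = 0<m
maxL-< (y ∷ α) 0<m (y<m ∷ α<m) = ⊔-lub y<m (maxL-< α 0<m α<m)

maxL-∈-positive : ∀ α → 0 < maxL α → maxL α ∈ α
maxL-∈-positive (y ∷ α) _ = maxL-∈ y α

-- β can follow the first occurrence of the maximum m of a 231-avoiding Cayley
-- permutation whose part before that occurrence has maximum b.
isTail : ℕ → ℕ → List ℕ → Bool
isTail m b β = (b <ᵇ m) ∧ (all (λ y → (b ≤ᵇ y) ∧ (y ≤ᵇ m)) β ∧ (covers b (m ∸ suc b) β ∧ not (contains231 β)))

record IsTail (m b : ℕ) (β : List ℕ) : Set where
  field
    below    : b < m
    bounded  : All (λ y → b ≤ y × y ≤ m) β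
    covering : Covers b (m ∸ suc b) β
    avoids   : contains231 β ≡ false

isTail⁺ : ∀ {m b} β → IsTail m b β → T (isTail m b β)
isTail⁺ {m} {b} β t = T-∧⁺ (<⇒<ᵇ below) (T-∧⁺ (all⁻ _ (All.map (λ (b≤y , y≤m) → T-∧⁺ (≤⇒≤ᵇ b≤y) (≤⇒≤ᵇ y≤m)) bounded))
                                             (T-∧⁺ (covers⁺ b (m ∸ suc b) β covering) (T-not⁺ avoids)))
  where open IsTail t

isTail⁻ : ∀ {m b} β → T (isTail m b β) → IsTail m b β
isTail⁻ {m} {b} β t = record
  { below    = <ᵇ⇒< b m (T-∧⁻ˡ (b <ᵇ m) t)
  ; bounded  = All.map (λ {y} t → ≤ᵇ⇒≤ b y (T-∧⁻ˡ (b ≤ᵇ y) t) , ≤ᵇ⇒≤ y m (T-∧⁻ʳ (b ≤ᵇ y) t))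
                       (all⁺ _ β (T-∧⁻ˡ (all _ β) rest))
  ; covering = covers⁻ b (m ∸ suc b) β (T-∧⁻ˡ (covers b (m ∸ suc b) β) rest′)
  ; avoids   = T-not⁻ (contains231 β) (T-∧⁻ʳ (covers b (m ∸ suc b) β) rest′)
  }
  where
  rest  = T-∧⁻ʳ (b <ᵇ m) t
  rest′ = T-∧⁻ʳ (all (λ y → (b ≤ᵇ y) ∧ (y ≤ᵇ m)) β) rest

IsCay231-++⁺ : ∀ {m} α β → All (_< m) α → All (0 <_) β → IsCay231 α → IsTail m (maxL α) β →
               IsCay231 (α ++ m ∷ β) × maxL (α ++ m ∷ β) ≡ m
IsCay231-++⁺ {m} α β α<m β>0 cα tβ =
  record { positive = ++⁺ α.positive (≤-<-trans z≤n β.below ∷ β>0) ; covering = cover ; avoids = avoid } , max≡m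
  where
  module α = IsCay231 cα
  module β = IsTail tβ
  b = maxL α
  w = α ++ m ∷ β
  β≤m : All (_≤ m) β
  β≤m = All.map proj₂ β.bounded
  max≡m : maxL w ≡ m
  max≡m = ≤-antisym (maxL-least w (++⁺ (All.map <⇒≤ α<m) (≤-refl ∷ β≤m))) (maxL-upper w (∈-++⁺ʳ α (here refl)))
  cover : Covers 0 (maxL w) w
  cover {k} k<max with suc k ≤? b | suc k ≟ m
  ... | yes k<b | _        = ∈-++⁺ˡ (α.covering k<b)
  ... | no _    | yes k+1≡m = ∈-++⁺ʳ α (here k+1≡m)
  ... | no k≮b  | no k+1≢m  = ∈-++⁺ʳ α (there (subst (_∈ β) (b+1+[k∸b]≡1+k b≤k)
                                (β.covering (k∸b<m∸1+b b k m b≤k (≤∧≢⇒< (subst (suc k ≤_) max≡m k<max) k+1≢m)))))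
    where
    b≤k = ≤-pred (≰⇒> k≮b)
  α≤mβ : All (λ x → All (x ≤_) (m ∷ β)) α
  α≤mβ = All.tabulate (λ x∈α → <⇒≤ (All.lookup α<m x∈α)
                              ∷ All.map (λ (b≤y , _) → ≤-trans (maxL-upper α x∈α) b≤y) β.bounded)
  avoid : contains231 w ≡ false
  avoid rewrite contains231-++ α (m ∷ β) α≤mβ | α.avoids | pair231-≤ m β β≤m = β.avoids

IsCay231-++⁻ : ∀ {m} α β → All (_< m) α → IsCay231 (α ++ m ∷ β) → maxL (α ++ m ∷ β) ≡ m →
               IsCay231 α × IsTail m (maxL α) β
IsCay231-++⁻ {m} α β α<m cw max≡m =
  record { positive = ++⁻ˡ α w.positive ; covering = coverα ; avoids = avoidα } ,
  record { below = b<m ; bounded = boundedβ ; covering = coverβ ; avoids = avoidβ }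
  where
  module w = IsCay231 cw
  b = maxL α
  w = α ++ m ∷ β
  0<m : 0 < m
  0<m = All.lookup w.positive (∈-++⁺ʳ α (here refl))
  b<m : b < m
  b<m = maxL-< α 0<m α<m
  w-covers : ∀ {k} → k < m → suc k ∈ w
  w-covers k<m = w.covering (subst (_ <_) (sym max≡m) k<m)
  no-smaller : ∀ {y} → y ∈ β → ¬ y < b
  no-smaller y∈β y<b = ≡false⇒¬T w.avoids
    (contains231-witness α β (maxL-∈-positive α (≤-<-trans z≤n y<b)) y∈β y<b b<m)
  coverα : Covers 0 b α
  coverα {k} k<b with suc k ≟ b | ∈-++⁻ α (w-covers (<-trans k<b b<m))
  ... | yes k+1≡b | _                 = subst (_∈ α) (sym k+1≡b) (maxL-∈-positive α (≤-<-trans z≤n k<b))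
  ... | no _     | inj₁ k∈α           = k∈α
  ... | no _     | inj₂ (here k+1≡m)  = ⊥-elim (<⇒≢ (≤-<-trans k<b b<m) k+1≡m)
  ... | no k+1≢b | inj₂ (there k∈β)   = ⊥-elim (no-smaller k∈β (≤∧≢⇒< k<b k+1≢b))
  avoidα : contains231 α ≡ false
  avoidα = ¬T⇒≡false (≡false⇒¬T w.avoids ∘ contains231-++ˡ α (m ∷ β))
  boundedβ : All (λ y → b ≤ y × y ≤ m) β
  boundedβ = All.tabulate (λ y∈β → ≮⇒≥ (no-smaller y∈β) , subst (_ ≤_) max≡m (maxL-upper w (∈-++⁺ʳ α (there y∈β))))
  coverβ : Covers b (m ∸ suc b) β
  coverβ {j} j<K with ∈-++⁻ α (w-covers (≤-<-trans (+-monoʳ-≤ b (n≤1+n j)) (j<m∸1+b⇒b+1+j<m b j m j<K)))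
  ... | inj₁ x∈α         = ⊥-elim (<⇒≱ (s≤s (m≤m+n b j)) (maxL-upper α x∈α))
  ... | inj₂ (here x≡m)  = ⊥-elim (<⇒≢ (j<m∸1+b⇒b+1+j<m b j m j<K) (trans (+-suc b j) x≡m))
  ... | inj₂ (there x∈β) = subst (_∈ β) (sym (+-suc b j)) x∈β
  avoidβ : contains231 β ≡ false
  avoidβ = ¬T⇒≡false (≡false⇒¬T w.avoids ∘ contains231-++ʳ α (m ∷ β) ∘ T-∨ʳ (pair231 m β))

isCay231Max : ℕ → List ℕ → Bool
isCay231Max b α = isCay231 α ∧ (b ≡ᵇ maxL α)

isMaxTail : ℕ → ℕ → List ℕ → Bool
isMaxTail m b []      = false
isMaxTail m b (x ∷ β) = (x ≡ᵇ m) ∧ isTail m b β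

⟦⟧-split-at-max : ∀ {m b} α γ → All (_< m) α → Maybe.All (λ y → ¬ T (y <ᵇ m)) (head γ) →
  All (0 <_) (α ++ γ) → α ++ γ ≢ [] →
  ⟦ isCay231Max b α ∧ isMaxTail m b γ ⟧ ≡ ⟦ isCay231 (α ++ γ) ∧ ((m ≡ᵇ maxL (α ++ γ)) ∧ (b ≡ᵇ maxL α)) ⟧
⟦⟧-split-at-max []      []      _   _ _ w≢[] = ⊥-elim (w≢[] refl)
⟦⟧-split-at-max {m} {b} (a ∷ α) [] α<m _ _ _ =
  trans (cong ⟦_⟧ (∧-zeroʳ (isCay231Max b (a ∷ α)))) (sym (⟦⟧-false max≢m))
  where
  max≢m : ¬ T (isCay231 (a ∷ α ++ []) ∧ ((m ≡ᵇ maxL (a ∷ α ++ [])) ∧ (b ≡ᵇ maxL (a ∷ α))))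
  max≢m t = <⇒≢ (All.lookup α<m (maxL-∈ a α)) (sym (trans m≡max (cong maxL (++-identityʳ (a ∷ α)))))
    where m≡max = ≡ᵇ⇒≡ m _ (T-∧⁻ˡ _ (T-∧⁻ʳ (isCay231 (a ∷ α ++ [])) t))
⟦⟧-split-at-max {m} {b} α (y ∷ β) α<m (just m≤y) pos _ = ⟦⟧-⇔ to from
  where
  w = α ++ y ∷ β
  β>0 : All (0 <_) β
  β>0 = All.tail (++⁻ʳ α pos)
  to : T (isCay231Max b α ∧ isMaxTail m b (y ∷ β)) → T (isCay231 w ∧ ((m ≡ᵇ maxL w) ∧ (b ≡ᵇ maxL α)))
  to t = subst (λ z → T (isCay231 (α ++ z ∷ β) ∧ ((m ≡ᵇ maxL (α ++ z ∷ β)) ∧ (b ≡ᵇ maxL α)))) (sym y≡m)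
           (T-∧⁺ (isCay231⁺ _ (proj₁ glued)) (T-∧⁺ (≡⇒≡ᵇ m _ (sym (proj₂ glued))) b≡ᵇmax))
    where
    cayα = T-∧⁻ˡ (isCay231Max b α) t
    tail = T-∧⁻ʳ (isCay231Max b α) t
    y≡m = ≡ᵇ⇒≡ y m (T-∧⁻ˡ (y ≡ᵇ m) tail)
    b≡ᵇmax = T-∧⁻ʳ (isCay231 α) cayα
    glued = IsCay231-++⁺ α β α<m β>0 (isCay231⁻ α (T-∧⁻ˡ (isCay231 α) cayα))
              (subst (λ c → IsTail m c β) (≡ᵇ⇒≡ b (maxL α) b≡ᵇmax) (isTail⁻ β (T-∧⁻ʳ (y ≡ᵇ m) tail)))
  from : T (isCay231 w ∧ ((m ≡ᵇ maxL w) ∧ (b ≡ᵇ maxL α))) → T (isCay231Max b α ∧ isMaxTail m b (y ∷ β))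
  from t = T-∧⁺ (T-∧⁺ (isCay231⁺ α (proj₁ cut)) (≡⇒≡ᵇ b _ b≡max))
                (T-∧⁺ (≡⇒≡ᵇ y m y≡m) (isTail⁺ β (subst (λ c → IsTail m c β) (sym b≡max) (proj₂ cut))))
    where
    cw = isCay231⁻ w (T-∧⁻ˡ (isCay231 w) t)
    m≡max = ≡ᵇ⇒≡ m (maxL w) (T-∧⁻ˡ (m ≡ᵇ maxL w) (T-∧⁻ʳ (isCay231 w) t))
    b≡max = ≡ᵇ⇒≡ b (maxL α) (T-∧⁻ʳ (m ≡ᵇ maxL w) (T-∧⁻ʳ (isCay231 w) t))
    y≡m = ≤-antisym (subst (y ≤_) (sym m≡max) (maxL-upper w (∈-++⁺ʳ α (here refl)))) (≮⇒≥ (m≤y ∘ <⇒<ᵇ))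
    cut = IsCay231-++⁻ α β α<m (subst (λ z → IsCay231 (α ++ z ∷ β)) y≡m cw)
                               (subst (λ z → maxL (α ++ z ∷ β) ≡ m) y≡m (sym m≡max))

maxL-positive : ∀ w → All (0 <_) w → w ≢ [] → 0 < maxL w
maxL-positive []      _         w≢[] = ⊥-elim (w≢[] refl)
maxL-positive (x ∷ w) (x>0 ∷ _) _    = <-≤-trans x>0 (maxL-upper (x ∷ w) (here refl))

∑<-indicator : ∀ n k → k < n → ∑[ i < n ] ⟦ i ≡ᵇ k ⟧ ≡ 1
∑<-indicator n k k<n = trans (∑<-cong n (λ i _ → sym (*-identityʳ ⟦ i ≡ᵇ k ⟧))) (∑<-select n k (λ _ → 1) k<n)

⟦⟧-split-word-at-max : ∀ m b w → All (0 <_) w → w ≢ [] →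
  ⟦ isCay231Max b (takeWhileᵇ (_<ᵇ m) w) ⟧ * ⟦ isMaxTail m b (dropWhileᵇ (_<ᵇ m) w) ⟧ ≡
  ⟦ isCay231 w ⟧ * (⟦ m ≡ᵇ maxL w ⟧ * ⟦ b ≡ᵇ maxL (takeWhileᵇ (_<ᵇ m) w) ⟧)
⟦⟧-split-word-at-max m b w w>0 w≢[] = begin
  ⟦ isCay231Max b α ⟧ * ⟦ isMaxTail m b γ ⟧
    ≡⟨ ⟦∧⟧ (isCay231Max b α) (isMaxTail m b γ) ⟨
  ⟦ isCay231Max b α ∧ isMaxTail m b γ ⟧
    ≡⟨ subst (λ v → ⟦ isCay231Max b α ∧ isMaxTail m b γ ⟧ ≡ ⟦ isCay231 v ∧ ((m ≡ᵇ maxL v) ∧ (b ≡ᵇ maxL α)) ⟧) α++γ≡w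
         (⟦⟧-split-at-max α γ (All.map (λ {x} → <ᵇ⇒< x m) (all-takeWhile (T? ∘ (_<ᵇ m)) w))
            (all-head-dropWhile (T? ∘ (_<ᵇ m)) w) (subst (All (0 <_)) (sym α++γ≡w) w>0) (w≢[] ∘ trans (sym α++γ≡w))) ⟩
  ⟦ isCay231 w ∧ ((m ≡ᵇ maxL w) ∧ (b ≡ᵇ maxL α)) ⟧
    ≡⟨ trans (⟦∧⟧ (isCay231 w) _) (cong (⟦ isCay231 w ⟧ *_) (⟦∧⟧ (m ≡ᵇ maxL w) (b ≡ᵇ maxL α))) ⟩
  ⟦ isCay231 w ⟧ * (⟦ m ≡ᵇ maxL w ⟧ * ⟦ b ≡ᵇ maxL α ⟧) ∎
  where
  open ≡-Reasoning
  α = takeWhileᵇ (_<ᵇ m) w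
  γ = dropWhileᵇ (_<ᵇ m) w
  α++γ≡w : α ++ γ ≡ w
  α++γ≡w = takeWhile++dropWhile (T? ∘ (_<ᵇ m)) w

⟦isCay231⟧-at-max : ∀ n w → All (Letter n) w → w ≢ [] →
  ⟦ isCay231 w ⟧ ≡ ∑[ m′ < n ] ∑[ b < suc n ]
    (⟦ isCay231Max b (takeWhileᵇ (_<ᵇ suc m′) w) ⟧ * ⟦ isMaxTail (suc m′) b (dropWhileᵇ (_<ᵇ suc m′) w) ⟧)
⟦isCay231⟧-at-max n w letters w≢[] = sym (begin
  ∑[ m′ < n ] ∑[ b < suc n ] (⟦ isCay231Max b (α m′) ⟧ * ⟦ isMaxTail (suc m′) b (dropWhileᵇ (_<ᵇ suc m′) w) ⟧)
    ≡⟨ ∑<-cong n (λ m′ _ → ∑<-cong (suc n) (λ b _ → ⟦⟧-split-word-at-max (suc m′) b w w>0 w≢[])) ⟩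
  ∑[ m′ < n ] ∑[ b < suc n ] (⟦ isCay231 w ⟧ * (⟦ suc m′ ≡ᵇ maxL w ⟧ * ⟦ b ≡ᵇ maxL (α m′) ⟧))
    ≡⟨ ∑<-cong n (λ m′ _ → trans (∑<-*ˡ (suc n) ⟦ isCay231 w ⟧ (λ b → ⟦ suc m′ ≡ᵇ maxL w ⟧ * ⟦ b ≡ᵇ maxL (α m′) ⟧))
                                 (cong (⟦ isCay231 w ⟧ *_) (∑<-*ˡ (suc n) ⟦ suc m′ ≡ᵇ maxL w ⟧ (λ b → ⟦ b ≡ᵇ maxL (α m′) ⟧)))) ⟩
  ∑[ m′ < n ] (⟦ isCay231 w ⟧ * (⟦ suc m′ ≡ᵇ maxL w ⟧ * ∑[ b < suc n ] ⟦ b ≡ᵇ maxL (α m′) ⟧))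
    ≡⟨ ∑<-*ˡ n ⟦ isCay231 w ⟧ (λ m′ → ⟦ suc m′ ≡ᵇ maxL w ⟧ * ∑[ b < suc n ] ⟦ b ≡ᵇ maxL (α m′) ⟧) ⟩
  ⟦ isCay231 w ⟧ * ∑[ m′ < n ] (⟦ suc m′ ≡ᵇ maxL w ⟧ * ∑[ b < suc n ] ⟦ b ≡ᵇ maxL (α m′) ⟧)
    ≡⟨ cong (⟦ isCay231 w ⟧ *_) unique-max ⟩
  ⟦ isCay231 w ⟧ * 1
    ≡⟨ *-identityʳ _ ⟩
  ⟦ isCay231 w ⟧ ∎)
  where
  open ≡-Reasoning
  w>0 = All.map proj₁ letters
  α : ℕ → List ℕ
  α m′ = takeWhileᵇ (_<ᵇ suc m′) w
  unique-max : ∑[ m′ < n ] (⟦ suc m′ ≡ᵇ maxL w ⟧ * ∑[ b < suc n ] ⟦ b ≡ᵇ maxL (α m′) ⟧) ≡ 1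
  unique-max with maxL w | maxL-positive w w>0 w≢[] | maxL-least w (All.map proj₂ letters)
  ... | suc M′ | _ | M′<n = trans (∑<-select n M′ (λ m′ → ∑[ b < suc n ] ⟦ b ≡ᵇ maxL (α m′) ⟧) M′<n)
                                  (∑<-indicator (suc n) (maxL (α M′)) (s≤s (maxL-least (α M′) α≤n)))
    where
    α≤n : All (_≤ n) (α M′)
    α≤n = All.map (λ {x} x<M → <⇒≤ (<-≤-trans (<ᵇ⇒< x (suc M′) x<M) M′<n)) (all-takeWhile (T? ∘ (_<ᵇ suc M′)) w)

-- Counting by the maximum

⟦⟧-weaken : ∀ {a b} → (T a → T b) → ⟦ a ⟧ ≡ ⟦ b ⟧ * ⟦ a ⟧
⟦⟧-weaken {false} {b}     _ = sym (*-zeroʳ ⟦ b ⟧)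
⟦⟧-weaken {true}  {true}  _ = refl
⟦⟧-weaken {true}  {false} f = ⊥-elim (f _)

cay231-as-∑ : ∀ ℓ → cay231 ℓ ≡ ∑[ w ∈ words ℓ ℓ ] ⟦ isCay231 w ⟧
cay231-as-∑ ℓ = count (words ℓ ℓ)
  where
  count : ∀ ws → length (filter (T? ∘ isCay231) ws) ≡ ∑[ w ∈ ws ] ⟦ isCay231 w ⟧
  count []       = refl
  count (w ∷ ws) with isCay231 w
  ... | true  = cong suc (count ws)
  ... | false = count ws

cayMax : ℕ → ℕ → ℕ
cayMax ℓ d = ∑[ α ∈ words ℓ d ] ⟦ isCay231Max d α ⟧

cayMax-alphabet : ∀ ℓ d M → d ≤ M → ∑[ α ∈ words ℓ M ] ⟦ isCay231Max d α ⟧ ≡ cayMax ℓ d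
cayMax-alphabet ℓ d M d≤M = begin
  ∑[ α ∈ words ℓ M ] ⟦ isCay231Max d α ⟧
    ≡⟨ ∑-words-cong ℓ M (λ α letters _ → ⟦⟧-weaken (within-d α letters)) ⟩
  ∑[ α ∈ words ℓ M ] (⟦ all (inWindow 0 d) α ⟧ * ⟦ isCay231Max d α ⟧)
    ≡⟨ ∑-words-window ℓ 0 d M d≤M (λ α → ⟦ isCay231Max d α ⟧) ⟩
  ∑[ α ∈ words ℓ d ] ⟦ isCay231Max d (map (0 +_) α) ⟧
    ≡⟨ ∑-cong (words ℓ d) (λ α → cong (λ v → ⟦ isCay231Max d v ⟧) (map-id α)) ⟩
  cayMax ℓ d ∎
  where
  open ≡-Reasoning
  within-d : ∀ α → All (Letter M) α → T (isCay231Max d α) → T (all (inWindow 0 d) α)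
  within-d α letters t = all⁻ _ (All.tabulate λ {x} x∈α →
    T-∧⁺ (<⇒<ᵇ (proj₁ (All.lookup letters x∈α)))
         (≤⇒≤ᵇ (subst (x ≤_) (sym (≡ᵇ⇒≡ d (maxL α) (T-∧⁻ʳ (isCay231 α) t))) (maxL-upper α x∈α))))

cayMax-vanish : ∀ ℓ d → ℓ < d → cayMax ℓ d ≡ 0
cayMax-vanish ℓ d ℓ<d = trans (∑-words-cong ℓ d (λ α _ ∣α∣≡ℓ → ⟦⟧-false (too-long α ∣α∣≡ℓ))) (∑-0 (words ℓ d))
  where
  too-long : ∀ α → length α ≡ ℓ → ¬ T (isCay231Max d α)
  too-long α refl t = <⇒≱ ℓ<d (subst (_≤ length α) (sym (≡ᵇ⇒≡ d (maxL α) (T-∧⁻ʳ (isCay231 α) t)))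
                                     (IsCay231⇒max≤length (isCay231⁻ α (T-∧⁻ˡ (isCay231 α) t))))

cay231-∑-cayMax : ∀ ℓ → cay231 ℓ ≡ ∑[ d < suc ℓ ] cayMax ℓ d
cay231-∑-cayMax ℓ = begin
  cay231 ℓ                                            ≡⟨ cay231-as-∑ ℓ ⟩
  ∑[ w ∈ words ℓ ℓ ] ⟦ isCay231 w ⟧                   ≡⟨ ∑-words-cong ℓ ℓ by-max ⟩
  ∑[ w ∈ words ℓ ℓ ] ∑[ d < suc ℓ ] ⟦ isCay231Max d w ⟧ ≡⟨ ∑-∑<-comm (words ℓ ℓ) (suc ℓ) (λ w d → ⟦ isCay231Max d w ⟧) ⟩
  ∑[ d < suc ℓ ] ∑[ w ∈ words ℓ ℓ ] ⟦ isCay231Max d w ⟧ ≡⟨ ∑<-cong (suc ℓ) (λ d d≤ℓ → cayMax-alphabet ℓ d ℓ (≤-pred d≤ℓ)) ⟩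
  ∑[ d < suc ℓ ] cayMax ℓ d                           ∎
  where
  open ≡-Reasoning
  by-max : ∀ w → All (Letter ℓ) w → length w ≡ ℓ → ⟦ isCay231 w ⟧ ≡ ∑[ d < suc ℓ ] ⟦ isCay231Max d w ⟧
  by-max w letters _ = sym (begin
    ∑[ d < suc ℓ ] ⟦ isCay231 w ∧ (d ≡ᵇ maxL w) ⟧ ≡⟨ ∑<-cong (suc ℓ) (λ d _ → ⟦∧⟧ (isCay231 w) (d ≡ᵇ maxL w)) ⟩
    ∑[ d < suc ℓ ] (⟦ isCay231 w ⟧ * ⟦ d ≡ᵇ maxL w ⟧) ≡⟨ ∑<-*ˡ (suc ℓ) ⟦ isCay231 w ⟧ (λ d → ⟦ d ≡ᵇ maxL w ⟧) ⟩
    ⟦ isCay231 w ⟧ * ∑[ d < suc ℓ ] ⟦ d ≡ᵇ maxL w ⟧ ≡⟨ cong (⟦ isCay231 w ⟧ *_) (∑<-indicator (suc ℓ) (maxL w) max<1+ℓ) ⟩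
    ⟦ isCay231 w ⟧ * 1                            ≡⟨ *-identityʳ _ ⟩
    ⟦ isCay231 w ⟧                                ∎)
    where max<1+ℓ = s≤s (maxL-least w (All.map proj₂ letters))

∑<-cayMax : ∀ ℓ N → ℓ < N → ∑< N (cayMax ℓ) ≡ cay231 ℓ
∑<-cayMax ℓ N ℓ<N = begin
  ∑< N (cayMax ℓ)                       ≡⟨ cong (λ t → ∑< t (cayMax ℓ)) (m+[n∸m]≡n ℓ<N) ⟨
  ∑< (suc ℓ + (N ∸ suc ℓ)) (cayMax ℓ)  ≡⟨ ∑<-extend (suc ℓ) (N ∸ suc ℓ) (cayMax ℓ) (cayMax-vanish ℓ) ⟩
  ∑< (suc ℓ) (cayMax ℓ)                 ≡⟨ cay231-∑-cayMax ℓ ⟨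
  cay231 ℓ                              ∎
  where open ≡-Reasoning

-- Counting tails

Covers-≤ : ∀ {c K K′ β} → K ≤ K′ → Covers c K′ β → Covers c K β
Covers-≤ K≤K′ cov k<K = cov (<-≤-trans k<K K≤K′)

Covers⇒≤maxL : ∀ K β → Covers 0 K β → K ≤ maxL β
Covers⇒≤maxL zero    β _   = z≤n
Covers⇒≤maxL (suc K) β cov = maxL-upper β (cov ≤-refl)

⟦∨⟧-exclusive : ∀ a b → ¬ (T a × T b) → ⟦ a ∨ b ⟧ ≡ ⟦ a ⟧ + ⟦ b ⟧
⟦∨⟧-exclusive true  true  excl = ⊥-elim (excl _)
⟦∨⟧-exclusive true  false _    = refl
⟦∨⟧-exclusive false b     _    = refl

⟦covers∧avoids⟧-by-max : ∀ K β → All (0 <_) β → maxL β ≤ suc K →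
  ⟦ covers 0 K β ∧ not (contains231 β) ⟧ ≡ ⟦ isCay231Max (suc K) β ⟧ + ⟦ isCay231Max K β ⟧
⟦covers∧avoids⟧-by-max K β β>0 max≤1+K =
  trans (⟦⟧-⇔ to from) (⟦∨⟧-exclusive (isCay231Max (suc K) β) (isCay231Max K β) exclusive)
  where
  max≡ : ∀ {d} → T (isCay231Max d β) → d ≡ maxL β
  max≡ {d} t = ≡ᵇ⇒≡ d (maxL β) (T-∧⁻ʳ (isCay231 β) t)
  exclusive : ¬ (T (isCay231Max (suc K) β) × T (isCay231Max K β))
  exclusive (t , t′) = 1+n≢n (trans (max≡ t) (sym (max≡ t′)))
  with-max : ∀ d → d ≡ maxL β → IsCay231 β → T (isCay231Max d β)
  with-max d d≡max c = T-∧⁺ (isCay231⁺ β c) (≡⇒≡ᵇ d (maxL β) d≡max)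
  to : T (covers 0 K β ∧ not (contains231 β)) → T (isCay231Max (suc K) β ∨ isCay231Max K β)
  to t with maxL β ≟ suc K
  ... | yes max≡1+K = T-∨ˡ _ (with-max (suc K) (sym max≡1+K) (record
          { positive = β>0 ; covering = cover ; avoids = avoid }))
    where
    cover : Covers 0 (maxL β) β
    cover {k} k<max with k ≟ K
    ... | yes refl = subst (_∈ β) max≡1+K (maxL-∈-positive β (subst (0 <_) (sym max≡1+K) (s≤s z≤n)))
    ... | no k≢K   = covers⁻ 0 K β (T-∧⁻ˡ (covers 0 K β) t) (≤∧≢⇒< (≤-pred (subst (k <_) max≡1+K k<max)) k≢K)
    avoid = T-not⁻ (contains231 β) (T-∧⁻ʳ (covers 0 K β) t)
  ... | no max≢1+K = T-∨ʳ (isCay231Max (suc K) β) (with-max K (sym max≡K) (record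
          { positive = β>0 ; covering = subst (λ M → Covers 0 M β) (sym max≡K) cov
          ; avoids = T-not⁻ (contains231 β) (T-∧⁻ʳ (covers 0 K β) t) }))
    where
    cov = covers⁻ 0 K β (T-∧⁻ˡ (covers 0 K β) t)
    max≡K = ≤-antisym (≤-pred (≤∧≢⇒< max≤1+K max≢1+K)) (Covers⇒≤maxL K β cov)
  from-cay231 : ∀ d → K ≤ d → T (isCay231Max d β) → T (covers 0 K β ∧ not (contains231 β))
  from-cay231 d K≤d t = T-∧⁺ (covers⁺ 0 K β (Covers-≤ {c = 0} (subst (K ≤_) (max≡ t) K≤d) c.covering)) (T-not⁺ c.avoids)
    where module c = IsCay231 (isCay231⁻ β (T-∧⁻ˡ (isCay231 β) t))
  from : T (isCay231Max (suc K) β ∨ isCay231Max K β) → T (covers 0 K β ∧ not (contains231 β))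
  from t with isCay231Max (suc K) β in e
  ... | true  = from-cay231 (suc K) (n≤1+n K) (subst T (sym e) _)
  ... | false = from-cay231 K ≤-refl t

cayMaxPair : ℕ → ℕ → ℕ
cayMaxPair ℓ K = cayMax ℓ (suc K) + cayMax ℓ K

∑-covering-window : ∀ ℓ c K n → c + suc K ≤ n →
  ∑[ β ∈ words ℓ n ] ⟦ all (inWindow c (suc K)) β ∧ (covers c K β ∧ not (contains231 β)) ⟧ ≡ cayMaxPair ℓ K
∑-covering-window ℓ c K n c+1+K≤n = begin
  ∑[ β ∈ words ℓ n ] ⟦ all (inWindow c (suc K)) β ∧ (covers c K β ∧ not (contains231 β)) ⟧
    ≡⟨ ∑-cong (words ℓ n) (λ β → ⟦∧⟧ (all (inWindow c (suc K)) β) _) ⟩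
  ∑[ β ∈ words ℓ n ] (⟦ all (inWindow c (suc K)) β ⟧ * ⟦ covers c K β ∧ not (contains231 β) ⟧)
    ≡⟨ ∑-words-window ℓ c (suc K) n c+1+K≤n (λ β → ⟦ covers c K β ∧ not (contains231 β) ⟧) ⟩
  ∑[ β ∈ words ℓ (suc K) ] ⟦ covers c K (map (c +_) β) ∧ not (contains231 (map (c +_) β)) ⟧
    ≡⟨ ∑-words-cong ℓ (suc K) (λ β letters _ → trans (cong₂ (λ u v → ⟦ u ∧ not v ⟧) (shift β) (contains231-map-+ c β))
         (⟦covers∧avoids⟧-by-max K β (All.map proj₁ letters) (maxL-least β (All.map proj₂ letters)))) ⟩
  ∑[ β ∈ words ℓ (suc K) ] (⟦ isCay231Max (suc K) β ⟧ + ⟦ isCay231Max K β ⟧)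
    ≡⟨ ∑-+ (words ℓ (suc K)) (λ β → ⟦ isCay231Max (suc K) β ⟧) (λ β → ⟦ isCay231Max K β ⟧) ⟩
  ∑[ β ∈ words ℓ (suc K) ] ⟦ isCay231Max (suc K) β ⟧ + ∑[ β ∈ words ℓ (suc K) ] ⟦ isCay231Max K β ⟧
    ≡⟨ cong₂ _+_ (cayMax-alphabet ℓ (suc K) (suc K) ≤-refl) (cayMax-alphabet ℓ K (suc K) (n≤1+n K)) ⟩
  cayMaxPair ℓ K ∎
  where
  open ≡-Reasoning
  shift : ∀ β → covers c K (map (c +_) β) ≡ covers 0 K β
  shift β = subst (λ c′ → covers c′ K (map (c +_) β) ≡ covers 0 K β) (+-identityʳ c) (covers-map-+ c 0 K β)

b+1+[m∸1+b]≡m : ∀ {b m} → b < m → b + suc (m ∸ suc b) ≡ m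
b+1+[m∸1+b]≡m {b} b<m = trans (+-suc b _) (m+[n∸m]≡n b<m)

⟦tail⟧-without-b : ∀ m b β → b < m →
  ⟦ not (elem b β) ∧ isTail m b β ⟧ ≡
  ⟦ all (inWindow b (suc (m ∸ suc b))) β ∧ (covers b (m ∸ suc b) β ∧ not (contains231 β)) ⟧
⟦tail⟧-without-b m b β b<m = ⟦⟧-⇔ to from
  where
  K = m ∸ suc b
  to : T (not (elem b β) ∧ isTail m b β) → T (all (inWindow b (suc K)) β ∧ (covers b K β ∧ not (contains231 β)))
  to t = T-∧⁺ (all⁻ _ (All.tabulate in-window)) (T-∧⁻ʳ (all _ β) (T-∧⁻ʳ (b <ᵇ m) tailT))
    where
    tailT = T-∧⁻ʳ (not (elem b β)) t
    module tail = IsTail (isTail⁻ {m} {b} β tailT)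
    b∉β : ¬ b ∈ β
    b∉β = ≡false⇒¬T (T-not⁻ (elem b β) (T-∧⁻ˡ (not (elem b β)) t)) ∘ elem⁺ β
    in-window : ∀ {y} → y ∈ β → T (inWindow b (suc K) y)
    in-window {y} y∈β = let (b≤y , y≤m) = All.lookup tail.bounded y∈β in
      T-∧⁺ (<⇒<ᵇ (≤∧≢⇒< b≤y (λ b≡y → b∉β (subst (_∈ β) (sym b≡y) y∈β))))
           (≤⇒≤ᵇ (subst (y ≤_) (sym (b+1+[m∸1+b]≡m b<m)) y≤m))
  from : T (all (inWindow b (suc K)) β ∧ (covers b K β ∧ not (contains231 β))) → T (not (elem b β) ∧ isTail m b β)
  from t = T-∧⁺ (T-not⁺ (¬T⇒≡false (λ e → <-irrefl refl (proj₁ (All.lookup window (elem⁻ β e))))))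
                (T-∧⁺ (<⇒<ᵇ b<m) (T-∧⁺ bounded (T-∧⁻ʳ (all (inWindow b (suc K)) β) t)))
    where
    window : All (λ y → b < y × y ≤ b + suc K) β
    window = All.map (λ {y} w → <ᵇ⇒< b y (T-∧⁻ˡ (b <ᵇ y) w) , ≤ᵇ⇒≤ y _ (T-∧⁻ʳ (b <ᵇ y) w))
                     (all⁺ _ β (T-∧⁻ˡ (all (inWindow b (suc K)) β) t))
    bounded : T (all (λ y → (b ≤ᵇ y) ∧ (y ≤ᵇ m)) β)
    bounded = all⁻ _ (All.map (λ {y} (b<y , y≤top) → T-∧⁺ (≤⇒≤ᵇ (<⇒≤ b<y)) (≤⇒≤ᵇ (subst (y ≤_) (b+1+[m∸1+b]≡m b<m) y≤top)))
                              window)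

Covers-suc⁻ : ∀ {c K β} → Covers c (suc K) β → Covers (suc c) K β
Covers-suc⁻ {c} {K} {β} cov {k} k<K = subst (_∈ β) (+-suc c (suc k)) (cov (s≤s k<K))

Covers-suc⁺ : ∀ {c K β} → suc c ∈ β → Covers (suc c) K β → Covers c (suc K) β
Covers-suc⁺ {c} {β = β} c+1∈β cov {zero}  _         = subst (_∈ β) (sym (trans (+-suc c 0) (cong suc (+-identityʳ c)))) c+1∈β
Covers-suc⁺ {c} {β = β} c+1∈β cov {suc k} (s≤s k<K) = subst (_∈ β) (sym (+-suc c (suc k))) (cov k<K)

⟦tail⟧-with-b : ∀ m c β → suc c < m →
  ⟦ elem (suc c) β ∧ isTail m (suc c) β ⟧ ≡
  ⟦ all (inWindow c (suc (suc (m ∸ suc (suc c))))) β ∧ (covers c (suc (m ∸ suc (suc c))) β ∧ not (contains231 β)) ⟧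
⟦tail⟧-with-b m c β b<m = ⟦⟧-⇔ to from
  where
  K = m ∸ suc (suc c)
  top : c + suc (suc K) ≡ m
  top = trans (+-suc c (suc K)) (b+1+[m∸1+b]≡m b<m)
  to : T (elem (suc c) β ∧ isTail m (suc c) β) →
       T (all (inWindow c (suc (suc K))) β ∧ (covers c (suc K) β ∧ not (contains231 β)))
  to t = T-∧⁺ (all⁻ _ (All.map (λ {y} (b≤y , y≤m) → T-∧⁺ (<⇒<ᵇ b≤y) (≤⇒≤ᵇ (subst (y ≤_) (sym top) y≤m))) tail.bounded))
              (T-∧⁺ (covers⁺ c (suc K) β (Covers-suc⁺ (elem⁻ β (T-∧⁻ˡ (elem (suc c) β) t)) tail.covering)) (T-not⁺ tail.avoids))
    where module tail = IsTail (isTail⁻ {m} {suc c} β (T-∧⁻ʳ (elem (suc c) β) t))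
  from : T (all (inWindow c (suc (suc K))) β ∧ (covers c (suc K) β ∧ not (contains231 β))) →
         T (elem (suc c) β ∧ isTail m (suc c) β)
  from t = T-∧⁺ (elem⁺ β (subst (_∈ β) (trans (+-suc c 0) (cong suc (+-identityʳ c))) (cover (s≤s z≤n))))
                (isTail⁺ β (record { below = b<m ; bounded = bounded ; covering = Covers-suc⁻ cover
                                   ; avoids = T-not⁻ (contains231 β) (T-∧⁻ʳ (covers c (suc K) β) rest) }))
    where
    rest = T-∧⁻ʳ (all (inWindow c (suc (suc K))) β) t
    cover = covers⁻ c (suc K) β (T-∧⁻ˡ (covers c (suc K) β) rest)
    bounded : All (λ y → suc c ≤ y × y ≤ m) β
    bounded = All.map (λ {y} w → <ᵇ⇒< c y (T-∧⁻ˡ (c <ᵇ y) w) , subst (y ≤_) top (≤ᵇ⇒≤ y _ (T-∧⁻ʳ (c <ᵇ y) w)))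
                      (all⁺ _ β (T-∧⁻ˡ (all (inWindow c (suc (suc K))) β) t))

∑-tails-without-b : ∀ ℓ n m b → b < m → m ≤ n →
  ∑[ β ∈ words ℓ n ] ⟦ not (elem b β) ∧ isTail m b β ⟧ ≡ cayMaxPair ℓ (m ∸ suc b)
∑-tails-without-b ℓ n m b b<m m≤n =
  trans (∑-cong (words ℓ n) (λ β → ⟦tail⟧-without-b m b β b<m))
        (∑-covering-window ℓ b (m ∸ suc b) n (subst (_≤ n) (sym (b+1+[m∸1+b]≡m b<m)) m≤n))

∑-tails-with-b : ∀ ℓ n m c → suc c < m → m ≤ n →
  ∑[ β ∈ words ℓ n ] ⟦ elem (suc c) β ∧ isTail m (suc c) β ⟧ ≡ cayMaxPair ℓ (suc (m ∸ suc (suc c)))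
∑-tails-with-b ℓ n m c b<m m≤n =
  trans (∑-cong (words ℓ n) (λ β → ⟦tail⟧-with-b m c β b<m))
        (∑-covering-window ℓ c (suc (m ∸ suc (suc c))) n
          (subst (_≤ n) (sym (trans (+-suc c _) (b+1+[m∸1+b]≡m b<m))) m≤n))

⟦⟧-split : ∀ e x → ⟦ x ⟧ ≡ ⟦ not e ∧ x ⟧ + ⟦ e ∧ x ⟧
⟦⟧-split true  x = refl
⟦⟧-split false x = sym (+-identityʳ ⟦ x ⟧)

-- A tail not containing b shifts down to a Cayley permutation with maximum
-- K + 1 or K; one containing b (possible only for b > 0) to one with maximum
-- K + 2 or K + 1.
tailsWith : ℕ → ℕ → ℕ → ℕ
tailsWith ℓ zero    K = cayMaxPair ℓ K
tailsWith ℓ (suc _) K = cayMaxPair ℓ K + cayMaxPair ℓ (suc K)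

∑-tails : ∀ ℓ n m b → b < m → m ≤ n → ∑[ β ∈ words ℓ n ] ⟦ isTail m b β ⟧ ≡ tailsWith ℓ b (m ∸ suc b)
∑-tails ℓ n m b b<m m≤n = begin
  ∑[ β ∈ words ℓ n ] ⟦ isTail m b β ⟧
    ≡⟨ ∑-cong (words ℓ n) (λ β → ⟦⟧-split (elem b β) (isTail m b β)) ⟩
  ∑[ β ∈ words ℓ n ] (⟦ not (elem b β) ∧ isTail m b β ⟧ + ⟦ elem b β ∧ isTail m b β ⟧)
    ≡⟨ ∑-+ (words ℓ n) (λ β → ⟦ not (elem b β) ∧ isTail m b β ⟧) (λ β → ⟦ elem b β ∧ isTail m b β ⟧) ⟩
  ∑[ β ∈ words ℓ n ] ⟦ not (elem b β) ∧ isTail m b β ⟧ + ∑[ β ∈ words ℓ n ] ⟦ elem b β ∧ isTail m b β ⟧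
    ≡⟨ cong (_+ ∑[ β ∈ words ℓ n ] ⟦ elem b β ∧ isTail m b β ⟧) (∑-tails-without-b ℓ n m b b<m m≤n) ⟩
  cayMaxPair ℓ (m ∸ suc b) + ∑[ β ∈ words ℓ n ] ⟦ elem b β ∧ isTail m b β ⟧
    ≡⟨ with-b b b<m ⟩
  tailsWith ℓ b (m ∸ suc b) ∎
  where
  open ≡-Reasoning
  with-b : ∀ b → b < m → cayMaxPair ℓ (m ∸ suc b) + ∑[ β ∈ words ℓ n ] ⟦ elem b β ∧ isTail m b β ⟧ ≡ tailsWith ℓ b (m ∸ suc b)
  with-b zero    _   = trans (cong (cayMaxPair ℓ (m ∸ 1) +_) no-zero) (+-identityʳ _)
    where
    no-zero : ∑[ β ∈ words ℓ n ] ⟦ elem 0 β ∧ isTail m 0 β ⟧ ≡ 0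
    no-zero = trans (∑-words-cong ℓ n (λ β letters _ → ⟦⟧-false (λ t →
                      <-irrefl refl (proj₁ (All.lookup letters (elem⁻ β (T-∧⁻ˡ (elem 0 β) t)))))))
                    (∑-0 (words ℓ n))
  with-b (suc c) b<m = cong (cayMaxPair ℓ (m ∸ suc (suc c)) +_) (∑-tails-with-b ℓ n m c b<m m≤n)

maxTails : ℕ → ℕ → ℕ → ℕ → ℕ
maxTails n m b j = ∑[ γ ∈ words j n ] ⟦ isMaxTail m b γ ⟧

maxTails-suc : ∀ n m′ b ℓ → m′ < n → maxTails n (suc m′) b (suc ℓ) ≡ ∑[ β ∈ words ℓ n ] ⟦ isTail (suc m′) b β ⟧
maxTails-suc n m′ b ℓ m′<n = begin
  maxTails n (suc m′) b (suc ℓ)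
    ≡⟨ ∑-words-suc ℓ n _ ⟩
  ∑[ a < n ] ∑[ β ∈ words ℓ n ] ⟦ (a ≡ᵇ m′) ∧ isTail (suc m′) b β ⟧
    ≡⟨ ∑<-cong n (λ a _ → trans (∑-cong (words ℓ n) (λ β → ⟦∧⟧ (a ≡ᵇ m′) (isTail (suc m′) b β)))
                                (∑-*ˡ (words ℓ n) ⟦ a ≡ᵇ m′ ⟧ (λ β → ⟦ isTail (suc m′) b β ⟧))) ⟩
  ∑[ a < n ] (⟦ a ≡ᵇ m′ ⟧ * ∑[ β ∈ words ℓ n ] ⟦ isTail (suc m′) b β ⟧)
    ≡⟨ ∑<-select n m′ (λ _ → ∑[ β ∈ words ℓ n ] ⟦ isTail (suc m′) b β ⟧) m′<n ⟩
  ∑[ β ∈ words ℓ n ] ⟦ isTail (suc m′) b β ⟧ ∎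
  where open ≡-Reasoning

maxTails-≥ : ∀ n m b j → ¬ b < m → maxTails n m b j ≡ 0
maxTails-≥ n m b j b≮m = trans (∑-cong (words j n) no-tail) (∑-0 (words j n))
  where
  no-tail : ∀ γ → ⟦ isMaxTail m b γ ⟧ ≡ 0
  no-tail []      = refl
  no-tail (x ∷ β) = ⟦⟧-false (λ t → b≮m (<ᵇ⇒< b m (T-∧⁻ˡ (b <ᵇ m) (T-∧⁻ʳ (x ≡ᵇ m) t))))

prefix*maxTails : ∀ n m b i j → b ≤ n →
  prefixSum n (_<ᵇ m) (⟦_⟧ ∘ isCay231Max b) i * maxTails n m b j ≡ cayMax i b * maxTails n m b j
prefix*maxTails n m b i j b≤n with b <? m
... | no b≮m rewrite maxTails-≥ n m b j b≮m =
  trans (*-zeroʳ (prefixSum n (_<ᵇ m) (⟦_⟧ ∘ isCay231Max b) i)) (sym (*-zeroʳ (cayMax i b)))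
... | yes b<m = cong (_* maxTails n m b j) (trans (∑-cong (words i n) (sym ∘ drop-bound)) (cayMax-alphabet i b n b≤n))
  where
  drop-bound : ∀ α → ⟦ isCay231Max b α ⟧ ≡ ⟦ all (_<ᵇ m) α ⟧ * ⟦ isCay231Max b α ⟧
  drop-bound α = ⟦⟧-weaken (λ t → all⁻ _ (All.tabulate (λ {x} x∈α →
    <⇒<ᵇ (≤-<-trans (subst (x ≤_) (sym (≡ᵇ⇒≡ b (maxL α) (T-∧⁻ʳ (isCay231 α) t))) (maxL-upper α x∈α)) b<m))))

tails : ℕ → ℕ → ℕ → ℕ
tails n ℓ b = ∑[ m′ < n ] ∑[ β ∈ words ℓ n ] ⟦ isTail (suc m′) b β ⟧

∑-split-at-max : ∀ n m b → b ≤ n →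
  ∑[ w ∈ words n n ] (⟦ isCay231Max b (takeWhileᵇ (_<ᵇ m) w) ⟧ * ⟦ isMaxTail m b (dropWhileᵇ (_<ᵇ m) w) ⟧) ≡
  ∑[ i < suc n ] (cayMax i b * maxTails n m b (n ∸ i))
∑-split-at-max n m b b≤n =
  trans (∑-words-split n (_<ᵇ m) n (⟦_⟧ ∘ isCay231Max b) (⟦_⟧ ∘ isMaxTail m b)
           (λ x γ x<m → ⟦⟧-false (λ t → <⇒≢ (<ᵇ⇒< x m x<m) (≡ᵇ⇒≡ x m (T-∧⁻ˡ (x ≡ᵇ m) t)))))
        (∑<-cong (suc n) (λ i _ → prefix*maxTails n m b i (n ∸ i) b≤n))

∑<-regroup : ∀ p q r (g : ℕ → ℕ → ℕ) (h : ℕ → ℕ → ℕ → ℕ) →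
  ∑[ x < p ] ∑[ y < q ] ∑[ z < r ] (g z y * h x y z) ≡ ∑[ z < r ] ∑[ y < q ] (g z y * ∑[ x < p ] h x y z)
∑<-regroup p q r g h = begin
  ∑[ x < p ] ∑[ y < q ] ∑[ z < r ] (g z y * h x y z) ≡⟨ ∑<-comm p q (λ x y → ∑[ z < r ] (g z y * h x y z)) ⟩
  ∑[ y < q ] ∑[ x < p ] ∑[ z < r ] (g z y * h x y z) ≡⟨ ∑<-cong q (λ y _ → ∑<-comm p r (λ x z → g z y * h x y z)) ⟩
  ∑[ y < q ] ∑[ z < r ] ∑[ x < p ] (g z y * h x y z) ≡⟨ ∑<-comm q r (λ y z → ∑[ x < p ] (g z y * h x y z)) ⟩
  ∑[ z < r ] ∑[ y < q ] ∑[ x < p ] (g z y * h x y z) ≡⟨ ∑<-cong r (λ z _ → ∑<-cong q (λ y _ → ∑<-*ˡ p (g z y) (λ x → h x y z))) ⟩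
  ∑[ z < r ] ∑[ y < q ] (g z y * ∑[ x < p ] h x y z) ∎
  where open ≡-Reasoning

cay231-decomposition : ∀ n′ →
  cay231 (suc n′) ≡ ∑[ i < suc n′ ] ∑[ b < suc (suc n′) ] (cayMax i b * tails (suc n′) (n′ ∸ i) b)
cay231-decomposition n′ = begin
  cay231 n
    ≡⟨ cay231-as-∑ n ⟩
  ∑[ w ∈ words n n ] ⟦ isCay231 w ⟧
    ≡⟨ ∑-words-cong n n (λ w letters ∣w∣≡n → ⟦isCay231⟧-at-max n w letters (λ w≡[] → 1+n≢0 (trans (sym ∣w∣≡n) (cong length w≡[])))) ⟩
  ∑[ w ∈ words n n ] ∑[ m′ < n ] ∑[ b < suc n ] term m′ b w
    ≡⟨ ∑-∑<-comm (words n n) n (λ w m′ → ∑[ b < suc n ] term m′ b w) ⟩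
  ∑[ m′ < n ] ∑[ w ∈ words n n ] ∑[ b < suc n ] term m′ b w
    ≡⟨ ∑<-cong n (λ m′ _ → ∑-∑<-comm (words n n) (suc n) (λ w b → term m′ b w)) ⟩
  ∑[ m′ < n ] ∑[ b < suc n ] ∑[ w ∈ words n n ] term m′ b w
    ≡⟨ ∑<-cong n (λ m′ _ → ∑<-cong (suc n) (λ b b≤n → ∑-split-at-max n (suc m′) b (≤-pred b≤n))) ⟩
  ∑[ m′ < n ] ∑[ b < suc n ] ∑[ i < suc n ] (cayMax i b * maxTails n (suc m′) b (n ∸ i))
    ≡⟨ ∑<-regroup n (suc n) (suc n) cayMax (λ m′ b i → maxTails n (suc m′) b (n ∸ i)) ⟩
  ∑[ i < suc n ] ∑[ b < suc n ] (cayMax i b * tails′ i b)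
    ≡⟨ ∑<-last n (λ i → ∑[ b < suc n ] (cayMax i b * tails′ i b)) ⟩
  ∑[ i < n ] ∑[ b < suc n ] (cayMax i b * tails′ i b) + ∑[ b < suc n ] (cayMax n b * tails′ n b)
    ≡⟨ cong₂ _+_ (∑<-cong n (λ i i<n → ∑<-cong (suc n) (λ b _ → cong (cayMax i b *_) (nonempty-tail i i<n b))))
                 (∑<-0 (suc n) (λ b → trans (cong (cayMax n b *_) (empty-tail b)) (*-zeroʳ (cayMax n b)))) ⟩
  ∑[ i < n ] ∑[ b < suc n ] (cayMax i b * tails n (n′ ∸ i) b) + 0
    ≡⟨ +-identityʳ _ ⟩
  ∑[ i < n ] ∑[ b < suc n ] (cayMax i b * tails n (n′ ∸ i) b) ∎
  where
  open ≡-Reasoning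
  n = suc n′
  term : ℕ → ℕ → List ℕ → ℕ
  term m′ b w = ⟦ isCay231Max b (takeWhileᵇ (_<ᵇ suc m′) w) ⟧ * ⟦ isMaxTail (suc m′) b (dropWhileᵇ (_<ᵇ suc m′) w) ⟧
  tails′ : ℕ → ℕ → ℕ
  tails′ i b = ∑[ m′ < n ] maxTails n (suc m′) b (n ∸ i)
  nonempty-tail : ∀ i → i < n → ∀ b → tails′ i b ≡ tails n (n′ ∸ i) b
  nonempty-tail i i<n b rewrite +-∸-assoc 1 (≤-pred i<n) =
    ∑<-cong n (λ m′ m′<n → maxTails-suc n m′ b (n′ ∸ i) m′<n)
  empty-tail : ∀ b → tails′ n b ≡ 0
  empty-tail b = ∑<-0 n (λ m′ → cong (maxTails n (suc m′) b) (n∸n≡0 n))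

⟦⟧-true : ∀ {a} → T a → ⟦ a ⟧ ≡ 1
⟦⟧-true {true} _ = refl

tails-as-∑ : ∀ n ℓ b → b ≤ n → tails n ℓ b ≡ ∑[ d < n ∸ b ] tailsWith ℓ b d
tails-as-∑ n ℓ b b≤n = begin
  tails n ℓ b
    ≡⟨ ∑<-cong n by-max ⟩
  ∑[ m′ < n ] (⟦ inWindow b (n ∸ b) (suc m′) ⟧ * tailsWith ℓ b (suc m′ ∸ suc b))
    ≡⟨ ∑<-window b (n ∸ b) n (≤-reflexive (m+[n∸m]≡n b≤n)) (λ m → tailsWith ℓ b (m ∸ suc b)) ⟩
  ∑[ d < n ∸ b ] tailsWith ℓ b (b + suc d ∸ suc b)
    ≡⟨ ∑<-cong (n ∸ b) (λ d _ → cong (tailsWith ℓ b) (trans (cong (_∸ suc b) (+-suc b d)) (m+n∸m≡n (suc b) d))) ⟩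
  ∑[ d < n ∸ b ] tailsWith ℓ b d ∎
  where
  open ≡-Reasoning
  by-max : ∀ m′ → m′ < n → ∑[ β ∈ words ℓ n ] ⟦ isTail (suc m′) b β ⟧ ≡
                           ⟦ inWindow b (n ∸ b) (suc m′) ⟧ * tailsWith ℓ b (suc m′ ∸ suc b)
  by-max m′ m′<n with b <? suc m′
  ... | yes b<m = trans (∑-tails ℓ n (suc m′) b b<m m′<n)
                        (sym (trans (cong (_* _) (⟦⟧-true (T-∧⁺ (<⇒<ᵇ b<m) (≤⇒≤ᵇ (subst (suc m′ ≤_) (sym (m+[n∸m]≡n b≤n)) m′<n)))))
                                    (*-identityˡ _)))
  ... | no b≮m  = trans (∑-cong (words ℓ n) (λ β → ⟦⟧-false (b≮m ∘ <ᵇ⇒< b (suc m′) ∘ T-∧⁻ˡ (b <ᵇ suc m′))))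
                        (trans (∑-0 (words ℓ n))
                               (sym (cong (_* _) (⟦⟧-false (b≮m ∘ <ᵇ⇒< b (suc m′) ∘ T-∧⁻ˡ (b <ᵇ suc m′))))))

∑<-cayMax-suc : ∀ ℓ N → ℓ < N → ∑[ d < N ] cayMax ℓ (suc d) + cayMax ℓ 0 ≡ cay231 ℓ
∑<-cayMax-suc ℓ N ℓ<N = trans (+-comm _ (cayMax ℓ 0)) (∑<-cayMax ℓ (suc N) (m<n⇒m<1+n ℓ<N))

∑<-cayMax-suc-suc : ∀ ℓ N → ℓ < N → ∑[ d < N ] cayMax ℓ (suc (suc d)) + cayMax ℓ 0 + cayMax ℓ 1 ≡ cay231 ℓ
∑<-cayMax-suc-suc ℓ N ℓ<N = begin
  ∑[ d < N ] cayMax ℓ (suc (suc d)) + cayMax ℓ 0 + cayMax ℓ 1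
    ≡⟨ rearrange (∑[ d < N ] cayMax ℓ (suc (suc d))) (cayMax ℓ 0) (cayMax ℓ 1) ⟩
  cayMax ℓ 0 + (cayMax ℓ 1 + ∑[ d < N ] cayMax ℓ (suc (suc d)))
    ≡⟨ ∑<-cayMax ℓ (suc (suc N)) (m<n⇒m<1+n (m<n⇒m<1+n ℓ<N)) ⟩
  cay231 ℓ ∎
  where
  open ≡-Reasoning
  rearrange : ∀ a b c → a + b + c ≡ b + (c + a)
  rearrange = solve-∀

tails-empty-prefix : ∀ n ℓ → ℓ < n → tails n ℓ 0 + cayMax ℓ 0 ≡ 2 * cay231 ℓ
tails-empty-prefix n ℓ ℓ<n = begin
  tails n ℓ 0 + cayMax ℓ 0
    ≡⟨ cong (_+ cayMax ℓ 0) (trans (tails-as-∑ n ℓ 0 z≤n) (∑<-+ n (λ d → cayMax ℓ (suc d)) (cayMax ℓ))) ⟩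
  ∑[ d < n ] cayMax ℓ (suc d) + ∑< n (cayMax ℓ) + cayMax ℓ 0
    ≡⟨ rearrange (∑[ d < n ] cayMax ℓ (suc d)) (∑< n (cayMax ℓ)) (cayMax ℓ 0) ⟩
  (∑[ d < n ] cayMax ℓ (suc d) + cayMax ℓ 0) + (∑< n (cayMax ℓ) + 0)
    ≡⟨ cong₂ (λ x y → x + (y + 0)) (∑<-cayMax-suc ℓ n ℓ<n) (∑<-cayMax ℓ n ℓ<n) ⟩
  2 * cay231 ℓ ∎
  where
  open ≡-Reasoning
  rearrange : ∀ a b c → a + b + c ≡ (a + c) + (b + 0)
  rearrange = solve-∀

tails-nonempty-prefix : ∀ n ℓ c → suc c + suc ℓ ≤ n →
  tails n ℓ (suc c) + (3 * cayMax ℓ 0 + cayMax ℓ 1) ≡ 4 * cay231 ℓ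
tails-nonempty-prefix n ℓ c bound = begin
  tails n ℓ (suc c) + (3 * cayMax ℓ 0 + cayMax ℓ 1)
    ≡⟨ cong (_+ (3 * cayMax ℓ 0 + cayMax ℓ 1)) (trans (tails-as-∑ n ℓ (suc c) (≤-trans (m≤m+n (suc c) (suc ℓ)) bound)) sums) ⟩
  ((A₁ + A₀) + (A₂ + A₁)) + (3 * cayMax ℓ 0 + cayMax ℓ 1)
    ≡⟨ rearrange A₁ A₀ A₂ (cayMax ℓ 0) (cayMax ℓ 1) ⟩
  (A₁ + cayMax ℓ 0) + (A₀ + ((A₂ + cayMax ℓ 0 + cayMax ℓ 1) + (A₁ + cayMax ℓ 0)))
    ≡⟨ cong₂ _+_ (∑<-cayMax-suc ℓ N ℓ<N) (cong₂ _+_ (∑<-cayMax ℓ N ℓ<N)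
                 (cong₂ _+_ (∑<-cayMax-suc-suc ℓ N ℓ<N) (∑<-cayMax-suc ℓ N ℓ<N))) ⟩
  cay231 ℓ + (cay231 ℓ + (cay231 ℓ + cay231 ℓ))
    ≡⟨ four-times (cay231 ℓ) ⟩
  4 * cay231 ℓ ∎
  where
  open ≡-Reasoning
  N = n ∸ suc c
  ℓ<N : ℓ < N
  ℓ<N = m+n≤o⇒m≤o∸n (suc ℓ) (subst (_≤ n) (+-comm (suc c) (suc ℓ)) bound)
  A₀ = ∑< N (cayMax ℓ)
  A₁ = ∑[ d < N ] cayMax ℓ (suc d)
  A₂ = ∑[ d < N ] cayMax ℓ (suc (suc d))
  sums : ∑[ d < N ] (cayMaxPair ℓ d + cayMaxPair ℓ (suc d)) ≡ (A₁ + A₀) + (A₂ + A₁)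
  sums = trans (∑<-+ N (cayMaxPair ℓ) (cayMaxPair ℓ ∘ suc))
               (cong₂ _+_ (∑<-+ N (λ d → cayMax ℓ (suc d)) (cayMax ℓ)) (∑<-+ N (λ d → cayMax ℓ (suc (suc d))) (λ d → cayMax ℓ (suc d))))
  rearrange : ∀ a₁ a₀ a₂ g₀ g₁ → ((a₁ + a₀) + (a₂ + a₁)) + (3 * g₀ + g₁) ≡ (a₁ + g₀) + (a₀ + ((a₂ + g₀ + g₁) + (a₁ + g₀)))
  rearrange = solve-∀
  four-times : ∀ x → x + (x + (x + x)) ≡ 4 * x
  four-times = solve-∀

words-unary : ∀ ℓ → words ℓ 1 ≡ replicate ℓ 1 ∷ []
words-unary zero    = refl
words-unary (suc ℓ) rewrite words-unary ℓ = refl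

maxL-ones : ∀ ℓ → maxL (replicate (suc ℓ) 1) ≡ 1
maxL-ones zero    = refl
maxL-ones (suc ℓ) rewrite maxL-ones ℓ = refl

cayMax-1 : ∀ ℓ → cayMax (suc ℓ) 1 ≡ 1
cayMax-1 ℓ rewrite words-unary (suc ℓ) = trans (+-identityʳ _) (⟦⟧-true (T-∧⁺ (isCay231⁺ ones record
  { positive = replicate⁺ (suc ℓ) (s≤s z≤n)
  ; covering = λ k<max → subst (_∈ ones) (cong suc (sym (n<1⇒n≡0 (subst (_ <_) (maxL-ones ℓ) k<max)))) (here refl)
  ; avoids   = ones-avoid (suc ℓ)
  }) (≡⇒≡ᵇ 1 (maxL ones) (sym (maxL-ones ℓ)))))
  where
  ones = replicate (suc ℓ) 1
  ones-avoid : ∀ k → contains231 (replicate k 1) ≡ false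
  ones-avoid zero    = refl
  ones-avoid (suc k) rewrite pair231-≤ 1 (replicate k 1) (replicate⁺ k ≤-refl) = ones-avoid k

tails-nonempty-prefix-independent : ∀ n ℓ c → suc c + suc ℓ ≤ n → tails n ℓ (suc c) ≡ tails n ℓ 1
tails-nonempty-prefix-independent n ℓ c bound = +-cancelʳ-≡ _ (tails n ℓ (suc c)) (tails n ℓ 1)
  (trans (tails-nonempty-prefix n ℓ c bound)
         (sym (tails-nonempty-prefix n ℓ 0 (≤-trans (s≤s (+-monoˡ-≤ (suc ℓ) z≤n)) bound))))

contribution-empty-prefix : ∀ n ℓ → ∑[ b < suc n ] (cayMax 0 b * tails n ℓ b) ≡ tails n ℓ 0
contribution-empty-prefix n ℓ = trans (cong₂ _+_ (*-identityˡ (tails n ℓ 0)) (∑<-0 n (λ _ → refl))) (+-identityʳ _)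

contribution-nonempty-prefix : ∀ n i ℓ → suc i + suc ℓ ≤ n →
  ∑[ b < suc n ] (cayMax (suc i) b * tails n ℓ b) ≡ cay231 (suc i) * tails n ℓ 1
contribution-nonempty-prefix n i ℓ bound = begin
  ∑[ c < n ] (cayMax (suc i) (suc c) * tails n ℓ (suc c))
    ≡⟨ ∑<-cong n (λ c _ → same-tails c) ⟩
  ∑[ c < n ] (cayMax (suc i) (suc c) * tails n ℓ 1)
    ≡⟨ ∑<-*ʳ n (tails n ℓ 1) (λ c → cayMax (suc i) (suc c)) ⟩
  ∑[ c < n ] cayMax (suc i) (suc c) * tails n ℓ 1
    ≡⟨ cong (_* tails n ℓ 1) (trans (sym (+-identityʳ _)) (∑<-cayMax-suc (suc i) n (<-≤-trans (m<m+n (suc i) (s≤s z≤n)) bound))) ⟩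
  cay231 (suc i) * tails n ℓ 1 ∎
  where
  open ≡-Reasoning
  same-tails : ∀ c → cayMax (suc i) (suc c) * tails n ℓ (suc c) ≡ cayMax (suc i) (suc c) * tails n ℓ 1
  same-tails c with suc c ≤? suc i
  ... | yes c<1+i = cong (cayMax (suc i) (suc c) *_)
                         (tails-nonempty-prefix-independent n ℓ c (≤-trans (+-monoˡ-≤ (suc ℓ) c<1+i) bound))
  ... | no c≮1+i rewrite cayMax-vanish (suc i) (suc c) (≰⇒> c≮1+i) = refl

cay231-recurrence : ∀ n′ →
  cay231 (suc n′) ≡ tails (suc n′) n′ 0 + ∑[ i < n′ ] (cay231 (suc i) * tails (suc n′) (n′ ∸ suc i) 1)
cay231-recurrence n′ = trans (cay231-decomposition n′)
  (cong₂ _+_ (contribution-empty-prefix (suc n′) n′)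
             (∑<-cong n′ (λ i i<n′ → contribution-nonempty-prefix (suc n′) i (n′ ∸ suc i)
                                       (≤-reflexive (cong suc (b+1+[m∸1+b]≡m i<n′))))))

∑ℤ : ℕ → (ℕ → ℤ) → ℤ
∑ℤ zero    f = ℤ.+ 0
∑ℤ (suc n) f = f 0 ℤ.+ ∑ℤ n (f ∘ suc)

syntax ∑ℤ n (λ i → e) = ∑ℤ[ i < n ] e

∑ℤ-cong : ∀ n {f g : ℕ → ℤ} → (∀ i → i < n → f i ≡ g i) → ∑ℤ n f ≡ ∑ℤ n g
∑ℤ-cong zero    eq = refl
∑ℤ-cong (suc n) eq = cong₂ ℤ._+_ (eq 0 (s≤s z≤n)) (∑ℤ-cong n (λ i i<n → eq (suc i) (s≤s i<n)))

∑ℤ-last : ∀ n (f : ℕ → ℤ) → ∑ℤ (suc n) f ≡ ∑ℤ n f ℤ.+ f n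
∑ℤ-last zero    f = trans (ℤ.+-identityʳ (f 0)) (sym (ℤ.+-identityˡ (f 0)))
∑ℤ-last (suc n) f = trans (cong (ℤ._+_ (f 0)) (∑ℤ-last n (f ∘ suc))) (sym (ℤ.+-assoc (f 0) _ _))

∑ℤ-reverse : ∀ n (f : ℕ → ℤ) → ∑ℤ (suc n) f ≡ ∑ℤ[ i < suc n ] f (n ∸ i)
∑ℤ-reverse zero    f = refl
∑ℤ-reverse (suc n) f = begin
  f 0 ℤ.+ ∑ℤ (suc n) (f ∘ suc)                    ≡⟨ cong (ℤ._+_ (f 0)) (∑ℤ-reverse n (f ∘ suc)) ⟩
  f 0 ℤ.+ ∑ℤ[ i < suc n ] f (suc (n ∸ i))          ≡⟨ ℤ.+-comm (f 0) _ ⟩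
  ∑ℤ[ i < suc n ] f (suc (n ∸ i)) ℤ.+ f 0          ≡⟨ cong₂ ℤ._+_ (∑ℤ-cong (suc n) (λ i i≤n → cong f (sym (+-∸-assoc 1 (≤-pred i≤n)))))
                                                                  (cong f (sym (n∸n≡0 (suc n)))) ⟩
  ∑ℤ[ i < suc n ] f (suc n ∸ i) ℤ.+ f (suc n ∸ suc n) ≡⟨ ∑ℤ-last (suc n) (λ i → f (suc n ∸ i)) ⟨
  ∑ℤ[ i < suc (suc n) ] f (suc n ∸ i)              ∎
  where open ≡-Reasoning

+-∑< : ∀ n f → ℤ.+ ∑< n f ≡ ∑ℤ[ i < n ] (ℤ.+ f i)
+-∑< zero    f = refl
+-∑< (suc n) f = trans (ℤ.pos-+ (f 0) (∑< n (f ∘ suc))) (cong (ℤ._+_ (ℤ.+ f 0)) (+-∑< n (f ∘ suc)))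

splitSum-as-∑ℤ : ∀ f n → splitSum f n ≡ ∑ℤ[ i < suc n ] f i (n ∸ i)
splitSum-as-∑ℤ f n = fold (λ i → i) (suc n)
  where
  fold : ∀ h m → foldr ℤ._+_ (ℤ.+ 0) (map (λ i → f i (n ∸ i)) (applyUpTo h m)) ≡ ∑ℤ[ i < m ] f (h i) (n ∸ h i)
  fold h zero    = refl
  fold h (suc m) = cong (ℤ._+_ (f (h 0) (n ∸ h 0))) (fold (h ∘ suc) m)

⊙𝕏-suc : ∀ (F : VSpecies) i → (F ⊙ 𝕏) (suc i) ≡ F i
⊙𝕏-suc F i = trans (splitSum-as-∑ℤ (λ a b → F a ℤ.* 𝕏 b) (suc i)) (lands-on F i)
  where
  lands-on : ∀ (F : VSpecies) i → ∑ℤ[ k < suc (suc i) ] (F k ℤ.* 𝕏 (suc i ∸ k)) ≡ F i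
  lands-on F zero    = trans (cong₂ ℤ._+_ (ℤ.*-identityʳ (F 0)) (cong (ℤ._+ ℤ.+ 0) (ℤ.*-zeroʳ (F 1)))) (ℤ.+-identityʳ (F 0))
  lands-on F (suc i) = trans (cong (ℤ._+ ∑ℤ[ k < suc (suc i) ] (F (suc k) ℤ.* 𝕏 (suc i ∸ k))) (ℤ.*-zeroʳ (F 0)))
                             (trans (ℤ.+-identityˡ _) (lands-on (F ∘ suc) i))

⊛-suc : ∀ (F G : VSpecies) n → (F ⊛ G) (suc n) ≡ ∑ℤ[ i < suc n ] (F (n ∸ i) ℤ.* G i)
⊛-suc F G n = begin
  (F ⊙ 𝕏 ⊙ G) (suc n)
    ≡⟨ splitSum-as-∑ℤ (λ i j → (F ⊙ 𝕏) i ℤ.* G j) (suc n) ⟩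
  (F ⊙ 𝕏) 0 ℤ.* G (suc n) ℤ.+ ∑ℤ[ i < suc n ] ((F ⊙ 𝕏) (suc i) ℤ.* G (n ∸ i))
    ≡⟨ cong₂ ℤ._+_ nothing-before-X (∑ℤ-cong (suc n) (λ i _ → cong (ℤ._* G (n ∸ i)) (⊙𝕏-suc F i))) ⟩
  ℤ.+ 0 ℤ.+ ∑ℤ[ i < suc n ] (F i ℤ.* G (n ∸ i))
    ≡⟨ ℤ.+-identityˡ _ ⟩
  ∑ℤ[ i < suc n ] (F i ℤ.* G (n ∸ i))
    ≡⟨ ∑ℤ-reverse n (λ i → F i ℤ.* G (n ∸ i)) ⟩
  ∑ℤ[ i < suc n ] (F (n ∸ i) ℤ.* G (n ∸ (n ∸ i)))
    ≡⟨ ∑ℤ-cong (suc n) (λ i i≤n → cong (λ j → F (n ∸ i) ℤ.* G j) (m∸[m∸n]≡n (≤-pred i≤n))) ⟩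
  ∑ℤ[ i < suc n ] (F (n ∸ i) ℤ.* G i) ∎
  where
  open ≡-Reasoning
  nothing-before-X : (F ⊙ 𝕏) 0 ℤ.* G (suc n) ≡ ℤ.+ 0
  nothing-before-X = cong (ℤ._* G (suc n)) (trans (ℤ.+-identityʳ (F 0 ℤ.* ℤ.+ 0)) (ℤ.*-zeroʳ (F 0)))

tails-empty-prefix-suc : ∀ n ℓ → suc ℓ < n → tails n (suc ℓ) 0 ≡ 2 * cay231 (suc ℓ)
tails-empty-prefix-suc n ℓ ℓ<n = trans (sym (+-identityʳ _)) (tails-empty-prefix n (suc ℓ) ℓ<n)

tails-nonempty-prefix-zero : ∀ n → 2 ≤ n → tails n 0 1 ≡ 1
tails-nonempty-prefix-zero n 2≤n = +-cancelʳ-≡ 3 (tails n 0 1) 1 (tails-nonempty-prefix n 0 0 2≤n)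

ℕ-sum⇒ℤ-difference : ∀ {a b c} → a + b ≡ c → ℤ.+ a ≡ ℤ.+ c ℤ.- ℤ.+ b
ℕ-sum⇒ℤ-difference {a} {b} refl =
  trans (sym (cancel (ℤ.+ a) (ℤ.+ b))) (cong (ℤ._- ℤ.+ b) (sym (ℤ.pos-+ a b)))
  where
  cancel : ∀ x y → x ℤ.+ y ℤ.- y ≡ x
  cancel = ℤ-Solver.solve-∀

tails-nonempty-prefix-suc : ∀ n ℓ → suc (suc ℓ) < n → ℤ.+ tails n (suc ℓ) 1 ≡ (4 · Cay231 ⊖ 𝔼) (suc ℓ)
tails-nonempty-prefix-suc n ℓ bound = begin
  ℤ.+ tails n (suc ℓ) 1                          ≡⟨ ℕ-sum⇒ℤ-difference tails+1≡4C ⟩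
  ℤ.+ (4 * cay231 (suc ℓ)) ℤ.- ℤ.+ 1              ≡⟨ cong (ℤ._- ℤ.+ 1) (ℤ.pos-* 4 (cay231 (suc ℓ))) ⟩
  ℤ.+ 4 ℤ.* ℤ.+ cay231 (suc ℓ) ℤ.- ℤ.+ 1          ∎
  where
  open ≡-Reasoning
  tails+1≡4C : tails n (suc ℓ) 1 + 1 ≡ 4 * cay231 (suc ℓ)
  tails+1≡4C = trans (cong (λ g → tails n (suc ℓ) 1 + g) (sym (cayMax-1 ℓ))) (tails-nonempty-prefix n (suc ℓ) 0 bound)

commonTerms : ℕ → ℤ
commonTerms k = ∑ℤ[ i < k ] ((4 · Cay231 ⊖ 𝔼) (k ∸ i) ℤ.* Cay231 (suc i))

Cay231-2+k : ∀ k → Cay231 (2 + k) ≡ ℤ.+ 2 ℤ.* Cay231 (suc k) ℤ.+ (commonTerms k ℤ.+ Cay231 (suc k))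
Cay231-2+k k = begin
  ℤ.+ cay231 (2 + k)
    ≡⟨ cong ℤ.+_ (cay231-recurrence (suc k)) ⟩
  ℤ.+ (t (suc k) 0 + ∑[ i < suc k ] (cay231 (suc i) * t (k ∸ i) 1))
    ≡⟨ ℤ.pos-+ (t (suc k) 0) _ ⟩
  ℤ.+ t (suc k) 0 ℤ.+ ℤ.+ ∑[ i < suc k ] (cay231 (suc i) * t (k ∸ i) 1)
    ≡⟨ cong₂ ℤ._+_ (cong ℤ.+_ (tails-empty-prefix-suc n k ≤-refl))
                   (trans (+-∑< (suc k) (λ i → cay231 (suc i) * t (k ∸ i) 1)) (∑ℤ-last k _)) ⟩
  ℤ.+ (2 * cay231 (suc k)) ℤ.+ (∑ℤ[ i < k ] (ℤ.+ (cay231 (suc i) * t (k ∸ i) 1)) ℤ.+ ℤ.+ (cay231 (suc k) * t (k ∸ k) 1))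
    ≡⟨ cong₂ ℤ._+_ (ℤ.pos-* 2 (cay231 (suc k))) (cong₂ ℤ._+_ (∑ℤ-cong k inner) last) ⟩
  ℤ.+ 2 ℤ.* Cay231 (suc k) ℤ.+ (commonTerms k ℤ.+ Cay231 (suc k)) ∎
  where
  open ≡-Reasoning
  n = 2 + k
  t = tails n
  inner : ∀ i → i < k → ℤ.+ (cay231 (suc i) * t (k ∸ i) 1) ≡ (4 · Cay231 ⊖ 𝔼) (k ∸ i) ℤ.* Cay231 (suc i)
  inner i i<k rewrite +-∸-assoc 1 i<k =
    trans (ℤ.pos-* (cay231 (suc i)) _)
          (trans (cong (Cay231 (suc i) ℤ.*_) (tails-nonempty-prefix-suc n (k ∸ suc i) (s≤s (s≤s (subst (_≤ k) (+-∸-assoc 1 i<k) (m∸n≤m k i))))))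
                 (ℤ.*-comm (Cay231 (suc i)) _))
  last : ℤ.+ (cay231 (suc k) * t (k ∸ k) 1) ≡ Cay231 (suc k)
  last = cong ℤ.+_ (trans (cong (λ j → cay231 (suc k) * t j 1) (n∸n≡0 k))
                          (trans (cong (cay231 (suc k) *_) (tails-nonempty-prefix-zero n (s≤s (s≤s z≤n))))
                                 (*-identityʳ _)))

⊛-at-2+k : ∀ k → (𝟙 ⊕ 𝕏 ⊕ (4 · Cay231 ⊖ 𝔼) ⊛ (Cay231 ₊)) (2 + k) ≡ commonTerms k ℤ.+ ℤ.+ 3 ℤ.* Cay231 (suc k)
⊛-at-2+k k = begin
  (𝟙 ⊕ 𝕏 ⊕ (4 · Cay231 ⊖ 𝔼) ⊛ (Cay231 ₊)) (2 + k)
    ≡⟨ ℤ.+-identityˡ _ ⟩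
  ((4 · Cay231 ⊖ 𝔼) ⊛ (Cay231 ₊)) (2 + k)
    ≡⟨ ⊛-suc (4 · Cay231 ⊖ 𝔼) (Cay231 ₊) (suc k) ⟩
  (4 · Cay231 ⊖ 𝔼) (suc k) ℤ.* ℤ.+ 0 ℤ.+ ∑ℤ[ i < suc k ] ((4 · Cay231 ⊖ 𝔼) (k ∸ i) ℤ.* Cay231 (suc i))
    ≡⟨ cong₂ ℤ._+_ (ℤ.*-zeroʳ ((4 · Cay231 ⊖ 𝔼) (suc k))) (∑ℤ-last k (λ i → (4 · Cay231 ⊖ 𝔼) (k ∸ i) ℤ.* Cay231 (suc i))) ⟩
  ℤ.+ 0 ℤ.+ (commonTerms k ℤ.+ (4 · Cay231 ⊖ 𝔼) (k ∸ k) ℤ.* Cay231 (suc k))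
    ≡⟨ ℤ.+-identityˡ _ ⟩
  commonTerms k ℤ.+ (4 · Cay231 ⊖ 𝔼) (k ∸ k) ℤ.* Cay231 (suc k)
    ≡⟨ cong (λ j → commonTerms k ℤ.+ (4 · Cay231 ⊖ 𝔼) j ℤ.* Cay231 (suc k)) (n∸n≡0 k) ⟩
  commonTerms k ℤ.+ ℤ.+ 3 ℤ.* Cay231 (suc k) ∎
  where open ≡-Reasoning

proposition6p9 : ∀ n → Cay231 n ≡ (𝟙 ⊕ 𝕏 ⊕ (4 · Cay231 ⊖ 𝔼) ⊛ (Cay231 ₊)) n
proposition6p9 zero          = refl
proposition6p9 (suc zero)    = refl
proposition6p9 (suc (suc k)) = begin
  Cay231 (2 + k)                                            ≡⟨ Cay231-2+k k ⟩
  ℤ.+ 2 ℤ.* Cay231 (suc k) ℤ.+ (commonTerms k ℤ.+ Cay231 (suc k)) ≡⟨ rearrange (Cay231 (suc k)) (commonTerms k) ⟩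
  commonTerms k ℤ.+ ℤ.+ 3 ℤ.* Cay231 (suc k)                     ≡⟨ ⊛-at-2+k k ⟨
  (𝟙 ⊕ 𝕏 ⊕ (4 · Cay231 ⊖ 𝔼) ⊛ (Cay231 ₊)) (2 + k)                                   ∎
  where
  open ≡-Reasoning
  rearrange : ∀ x m → ℤ.+ 2 ℤ.* x ℤ.+ (m ℤ.+ x) ≡ m ℤ.+ ℤ.+ 3 ℤ.* x
  rearrange = ℤ-Solver.solve-∀
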